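{- Let $V_0,V_1,\dots$ be indeterminates and let $\mathbf{b}=(b_i)_{i\ge0}$, $\boldsymbol{\lambda}=(\lambda_i)_{i\ge1}$ be given by $b_i=-V_i^{ -1}$ and $\lambda_i=V_i^{ -1}V_{i-1}^{ -1}$. For all integers $k\ge1$, $n\ge1$ and $0\le r,s\le 3k-1$, \[ \mu^{\le 3k-1}_{ -n,r,s}(\mathbf{b},\boldsymbol{\lambda})=(-1)^{\lfloor r/3\rfloor+\lfloor s/3\rfloor}\frac{V_0\cdots V_s}{V_0\cdots V_{r-1}}\sum_{\pi\in\mathrm{PV}^{3,3k-1}_{n-1,r,s}}\mathrm{wt}(\pi), \] where $V_0\cdots V_{r-1}=1$ if $r=0$.
   Context: A Motzkin path is a finite sequence of points in $\mathbb{Z}\times\mathbb{Z}_{\ge0}$ whose steps are each $(1,1)$, $(1,0)$ or $(1,-1)$; its weight is the product of $b_i$ over horizontal steps starting at height $i$ and $\lambda_i$ over down steps starting at height $i$. $\mu^{\le K}_{N,r,s}(\mathbf{b},\boldsymbol{\lambda})$ ($N\ge0$) is the sum of weights of Motzkin paths from $(0,r)$ to $(N,s)$ staying weakly below $y=K$. If $(f_N)_{N\ge0}$ satisfies $f_N=c_1f_{N-1}+\cdots+c_df_{N-d}$ for all $N\ge d$ with $c_d\ne0$, it is extended uniquely to all $N\in\mathbb{Z}$ so the recurrence holds for all $N$; $\mu^{\le K}_{ -N,r,s}$ denotes this extension (it exists here). $\mathrm{wt}((a_1,\dots,a_N))=V_{a_1}\cdots V_{a_N}$. A $(3,r,s)$-peak-valley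 sequence is a sequence $(a_1,\dots,a_N)$ of nonnegative integers such that, setting $a_0=r$ and $a_{N+1}=s$, for each $i=0,\dots,N+1$: if $a_i\equiv0\pmod3$ then $a_{i-1}>a_i<a_{i+1}$, and if $a_i\equiv2\pmod3$ then $a_{i-1}<a_i>a_{i+1}$, where inequalities involving $a_{ -1}$ or $a_{N+2}$ are ignored. $\mathrm{PV}^{3,K}_{N,r,s}$ is the set of such sequences with $0\le a_i\le K$ for $1\le i\le N$. -}

module Defs where

open import Level using (Level; _⊔_) renaming (suc to lsuc)
open import Algebra.Bundles using (CommutativeRing)
open import Data.Nat as ℕ using (ℕ; zero; suc; _≤_; _<_; _≡ᵇ_; _<ᵇ_; _%_; _/_; _∸_)
open import Data.Integer as ℤ using (ℤ)
open import Data.Bool using (Bool; true; false; _∧_; if_then_else_)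
open import Data.List using (List; []; _∷_; _++_; [_]; map; concatMap; upTo; foldr; length)
open import Data.Maybe using (Maybe; just; nothing)
open import Data.Product using (Σ; _,_)
open import Relation.Nullary using (¬_)

record Field (c ℓ : Level) : Set (lsuc (c ⊔ ℓ)) where
  field
    commutativeRing : CommutativeRing c ℓ
  open CommutativeRing commutativeRing public
  field
    1≉0     : ¬ (1# ≈ 0#)
    inverse : ∀ x → ¬ (x ≈ 0#) → Σ Carrier (λ y → (x * y) ≈ 1#)

data Step : Set where
  up flat down : Step

allSteps : ℕ → List (List Step)
allSteps zero    = [] ∷ []
allSteps (suc N) = concatMap (λ w → (up ∷ w) ∷ (flat ∷ w) ∷ (down ∷ w) ∷ []) (allSteps N)

walk : ℕ → ℕ → List Step → Maybe ℕ
walk K h []           = just h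
walk K h (up ∷ w)     = if K <ᵇ suc h then nothing else walk K (suc h) w
walk K h (flat ∷ w)   = walk K h w
walk K zero (down ∷ w) = nothing
walk K (suc h) (down ∷ w) = walk K h w

endsAt : Maybe ℕ → ℕ → Bool
endsAt (just h) s = h ≡ᵇ s
endsAt nothing  s = false

allSeqs : ℕ → ℕ → List (List ℕ)
allSeqs K zero    = [] ∷ []
allSeqs K (suc N) = concatMap (λ w → map (λ a → a ∷ w) (upTo (suc K))) (allSeqs K N)

gtOpt : Maybe ℕ → ℕ → Bool
gtOpt nothing  a = true
gtOpt (just x) a = a <ᵇ x

ltOpt : Maybe ℕ → ℕ → Bool
ltOpt nothing  a = true
ltOpt (just x) a = x <ᵇ a

condAt : Maybe ℕ → ℕ → Maybe ℕ → Bool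
condAt p a q with a % 3
... | 0 = gtOpt p a ∧ gtOpt q a
... | 2 = ltOpt p a ∧ ltOpt q a
... | _ = true

pvCheck : Maybe ℕ → List ℕ → Bool
pvCheck p []           = true
pvCheck p (a ∷ [])     = condAt p a nothing
pvCheck p (a ∷ b ∷ l)  = condAt p a (just b) ∧ pvCheck (just a) (b ∷ l)

isPV : ℕ → ℕ → List ℕ → Bool
isPV r s l = pvCheck nothing (r ∷ l ++ [ s ])

module _ {c ℓ : Level} (F : Field c ℓ) where
  open Field F

  sumR : List Carrier → Carrier
  sumR = foldr _+_ 0#

  prodUpTo : (ℕ → Carrier) → ℕ → Carrier
  prodUpTo f zero    = 1#
  prodUpTo f (suc n) = prodUpTo f n * f n

  negOnePow : ℕ → Carrier
  negOnePow zero    = 1#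
  negOnePow (suc m) = - 1# * negOnePow m

  module _ (V Vinv : ℕ → Carrier) where

    bW : ℕ → Carrier
    bW i = - Vinv i

    λW : ℕ → Carrier
    λW i = Vinv i * Vinv (i ∸ 1)

    pathWeight : ℕ → List Step → Carrier
    pathWeight h []         = 1#
    pathWeight h (up ∷ w)   = pathWeight (suc h) w
    pathWeight h (flat ∷ w) = bW h * pathWeight h w
    pathWeight h (down ∷ w) = λW h * pathWeight (h ∸ 1) w

    mu : ℕ → ℕ → ℕ → ℕ → Carrier
    mu K N r s = sumR (concatMap (λ w → if endsAt (walk K r w) s then [ pathWeight r w ] else [])
                                 (allSteps N))

    wt : List ℕ → Carrier
    wt = foldr (λ a x → V a * x) 1#

    pvSum : ℕ → ℕ → ℕ → ℕ → Carrier
    pvSum K N r s = sumR (concatMap (λ l → if isPV r s l then [ wt l ] else []) (allSeqs K N))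

  sumFrom1 : ℕ → (ℕ → Carrier) → Carrier
  sumFrom1 zero    f = 0#
  sumFrom1 (suc d) f = sumFrom1 d f + f (suc d)

module Submission where

-- Let A be the transfer matrix of the weights on heights 0 … K, K = 3k − 1 (1 above, b on and
-- λ below the diagonal), so that μ^{≤K}_{N,r,s} = (A^N)_{rs}. The matrices G_m with entries
-- (−1)^{⌊y/3⌋+⌊t/3⌋} (V_0⋯V_t / V_0⋯V_{y−1}) Σ_{π ∈ PV^{3,K}_{m,y,t}} wt(π) satisfy
-- G_{m+1} = G_0 G_m (split off the first entry of a sequence) and A G_0 = 1; the latter is a
-- finite check over the residues mod 3 of row and column index and their relative position, and
-- needs K ≡ 2 (mod 3). So G_m = A^{−1−m}, and N ↦ (A^N)_{rs} continued by G solves the transfer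
-- recursion on all of ℤ. Every such solution is annihilated by the characteristic polynomial of
-- A, obtained from the three-term recurrence of orthogonal polynomials, whose constant term is
-- ±(V_0⋯V_K)^{−1} ≠ 0 because 3 divides K + 1. A sequence on ℤ satisfying a linear recurrence
-- with invertible extreme coefficients is determined by its values on ℕ; applying this to the
-- recurrence of g and to the characteristic polynomial identifies g with the continuation.

open import Defs
open import Level using (Level)
open import Data.Nat as ℕ using (ℕ; zero; suc; _≤_; _<_; _∸_; _/_; _%_; _<ᵇ_; _≡ᵇ_; z≤n; s≤s)
import Data.Nat.Properties as ℕP
import Data.Nat.DivMod as ℕDM
open import Data.Nat.Divisibility using (divides-refl)
open import Data.Bool using (Bool; true; false; _∧_; _∨_; not; if_then_else_; T)
open import Data.Bool.Properties using (∧-identityʳ; ∧-assoc; T-∧)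
open import Function.Bundles using (Equivalence)
open import Data.List using (List; []; _∷_; _++_; [_]; map; concatMap; upTo; cartesianProduct)
import Data.List.Properties as ListP
open import Data.Maybe using (just; nothing)
open import Data.Product using (Σ; _,_; _×_; proj₁; proj₂)
open import Data.Sum using (_⊎_; inj₁; inj₂)
open import Data.Empty using (⊥-elim)
open import Data.Fin using (#_)
open import Data.Vec using () renaming (_∷_ to _∷ᵥ_; [] to []ᵥ)
open import Data.Integer as ℤ using (ℤ)
open import Data.Integer.Base using (-[1+_])
import Data.Integer.Properties as ℤP
open import Data.Integer.Tactic.RingSolver using (solve-∀)
open import Relation.Nullary using (¬_)
open import Relation.Binary.PropositionalEquality as ≡ using (_≡_)
import Algebra.Solver.CommutativeMonoid as CommutativeMonoidSolver

module Combinatorics where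
  open import Relation.Binary.PropositionalEquality hiding ([_])
  open import Data.Bool.ListAction using (all)
  open import Data.List.Membership.Propositional using (_∈_)
  open import Data.List.Membership.Propositional.Properties using (∈-cartesianProduct⁺)
  open import Data.List.Relation.Unary.All using (lookup)
  open import Data.List.Relation.Unary.All.Properties using (all⁺)
  open import Data.List.Relation.Unary.Any using (here; there)

  data Residue : Set where
    r0 r1 r2 : Residue

  residueOf : ℕ → Residue
  residueOf 0 = r0
  residueOf 1 = r1
  residueOf _ = r2

  residue : ℕ → Residue
  residue n = residueOf (n % 3)

  next prev : Residue → Residue
  next r0 = r1
  next r1 = r2
  next r2 = r0
  prev r0 = r2
  prev r1 = r0
  prev r2 = r1

  prev-next : ∀ i → prev (next i) ≡ i
  prev-next r0 = refl
  prev-next r1 = refl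
  prev-next r2 = refl

  carry : Residue → ℕ
  carry r2 = 1
  carry _  = 0

  remainder-cases : ∀ x → x % 3 ≡ 0 ⊎ x % 3 ≡ 1 ⊎ x % 3 ≡ 2
  remainder-cases x with x % 3 | ℕDM.m%n<n x 3
  ... | 0 | _ = inj₁ refl
  ... | 1 | _ = inj₂ (inj₁ refl)
  ... | 2 | _ = inj₂ (inj₂ refl)
  ... | suc (suc (suc _)) | s≤s (s≤s (s≤s ()))

  suc-%3 : ∀ x → suc x % 3 ≡ suc (x % 3) % 3
  suc-%3 x = ℕDM.%-distribˡ-+ 1 x 3

  suc-/3 : ∀ x → suc x / 3 ≡ suc (x % 3) / 3 ℕ.+ x / 3
  suc-/3 x = begin
    suc x / 3                            ≡⟨ cong (λ y → suc y / 3) (ℕDM.m≡m%n+[m/n]*n x 3) ⟩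
    (suc (x % 3) ℕ.+ x / 3 ℕ.* 3) / 3    ≡⟨ ℕDM.+-distrib-/-∣ʳ (suc (x % 3)) (divides-refl (x / 3)) ⟩
    suc (x % 3) / 3 ℕ.+ x / 3 ℕ.* 3 / 3  ≡⟨ cong (suc (x % 3) / 3 ℕ.+_) (ℕDM.m*n/n≡m (x / 3) 3) ⟩
    suc (x % 3) / 3 ℕ.+ x / 3            ∎
    where open ≡-Reasoning

  residue-suc : ∀ x → residue (suc x) ≡ next (residue x)
  residue-suc x with remainder-cases x
  ... | inj₁ e        rewrite suc-%3 x | e = refl
  ... | inj₂ (inj₁ e) rewrite suc-%3 x | e = refl
  ... | inj₂ (inj₂ e) rewrite suc-%3 x | e = refl

  prev-residue-suc : ∀ x → residue x ≡ prev (residue (suc x))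
  prev-residue-suc x = trans (sym (prev-next (residue x))) (cong prev (sym (residue-suc x)))

  /3-suc : ∀ x → suc x / 3 ≡ carry (residue x) ℕ.+ x / 3
  /3-suc x with remainder-cases x
  ... | inj₁ e        rewrite suc-/3 x | e = refl
  ... | inj₂ (inj₁ e) rewrite suc-/3 x | e = refl
  ... | inj₂ (inj₂ e) rewrite suc-/3 x | e = refl

  <ᵇ-true : ∀ {m n} → m < n → (m <ᵇ n) ≡ true
  <ᵇ-true {zero}  (s≤s _) = refl
  <ᵇ-true {suc m} (s≤s p) = <ᵇ-true p

  <ᵇ-false : ∀ {m n} → n ≤ m → (m <ᵇ n) ≡ false
  <ᵇ-false {n = zero}  _       = refl
  <ᵇ-false {n = suc n} (s≤s p) = <ᵇ-false p

  ≡ᵇ-refl : ∀ n → (n ≡ᵇ n) ≡ true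
  ≡ᵇ-refl zero    = refl
  ≡ᵇ-refl (suc n) = ≡ᵇ-refl n

  ≡ᵇ-< : ∀ {m n} → m < n → (m ≡ᵇ n) ≡ false
  ≡ᵇ-< {zero}  (s≤s _) = refl
  ≡ᵇ-< {suc m} (s≤s p) = ≡ᵇ-< p

  ≡ᵇ-> : ∀ {m n} → n < m → (m ≡ᵇ n) ≡ false
  ≡ᵇ-> {n = zero}  (s≤s _) = refl
  ≡ᵇ-> {n = suc n} (s≤s p) = ≡ᵇ-> p

  data Side : Set where
    below level above : Side

  isBelow isAbove : Side → Bool
  isBelow below = true
  isBelow _     = false
  isAbove above = true
  isAbove _     = false

  isLevel : Side → Bool
  isLevel level = true
  isLevel _     = false

  SideOf : ℕ → ℕ → Side → Set
  SideOf y a below = a < y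
  SideOf y a level = a ≡ y
  SideOf y a above = y < a

  <ᵇ-side : ∀ {y a} s → SideOf y a s → ((y <ᵇ a) ≡ isAbove s) × ((a <ᵇ y) ≡ isBelow s)
  <ᵇ-side below a<y  = <ᵇ-false (ℕP.<⇒≤ a<y) , <ᵇ-true a<y
  <ᵇ-side {y} level refl = <ᵇ-false (ℕP.≤-refl {y}) , <ᵇ-false (ℕP.≤-refl {y})
  <ᵇ-side above y<a  = <ᵇ-true y<a , <ᵇ-false (ℕP.<⇒≤ y<a)

  ≡ᵇ-side : ∀ {y a} s → SideOf y a s → (y ≡ᵇ a) ≡ isLevel s
  ≡ᵇ-side below a<y      = ≡ᵇ-> a<y
  ≡ᵇ-side {y} level refl = ≡ᵇ-refl y
  ≡ᵇ-side above y<a      = ≡ᵇ-< y<a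

  condAt-split : ∀ p a q → condAt p a q ≡ condAt p a nothing ∧ condAt nothing a q
  condAt-split p a q with a % 3
  ... | 0                 = cong (_∧ gtOpt q a) (sym (∧-identityʳ (gtOpt p a)))
  ... | 1                 = refl
  ... | 2                 = cong (_∧ ltOpt q a) (sym (∧-identityʳ (ltOpt p a)))
  ... | suc (suc (suc _)) = refl

  condAt-isolated : ∀ a → condAt nothing a nothing ≡ true
  condAt-isolated a with a % 3
  ... | 0                 = refl
  ... | 1                 = refl
  ... | 2                 = refl
  ... | suc (suc (suc _)) = refl

  pvCheck-just : ∀ y a l → pvCheck (just y) (a ∷ l) ≡ condAt (just y) a nothing ∧ pvCheck nothing (a ∷ l)
  pvCheck-just y a []      =
    trans (sym (∧-identityʳ _)) (cong (condAt (just y) a nothing ∧_) (sym (condAt-isolated a)))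
  pvCheck-just y a (b ∷ l) =
    trans (cong (_∧ pvCheck (just a) (b ∷ l)) (condAt-split (just y) a (just b)))
          (∧-assoc (condAt (just y) a nothing) (condAt nothing a (just b)) (pvCheck (just a) (b ∷ l)))

  isPV-∷ : ∀ y t a w → isPV y t (a ∷ w) ≡ isPV y a [] ∧ isPV a t w
  isPV-∷ y t a w = trans (cong (condAt nothing y (just a) ∧_) (pvCheck-just y a (w ++ [ t ])))
                         (sym (∧-assoc (condAt nothing y (just a)) (condAt (just y) a nothing) (isPV a t w)))

  leftAdmissible rightAdmissible : Residue → Side → Bool
  leftAdmissible r0 s = isAbove s
  leftAdmissible r1 s = true
  leftAdmissible r2 s = isBelow s
  rightAdmissible r0 s = isBelow s
  rightAdmissible r1 s = true
  rightAdmissible r2 s = isAbove s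

  admissible : Residue → Residue → Side → Bool
  admissible i j s = leftAdmissible i s ∧ rightAdmissible j s

  isPV-pair : ∀ y a s → SideOf y a s → isPV y a [] ≡ admissible (residue y) (residue a) s
  isPV-pair y a s side = cong₂ _∧_ left right
    where
    left : condAt nothing y (just a) ≡ leftAdmissible (residue y) s
    left with remainder-cases y
    ... | inj₁ e        rewrite e = proj₁ (<ᵇ-side s side)
    ... | inj₂ (inj₁ e) rewrite e = refl
    ... | inj₂ (inj₂ e) rewrite e = proj₂ (<ᵇ-side s side)
    right : condAt (just y) a nothing ≡ rightAdmissible (residue a) s
    right with remainder-cases a
    ... | inj₁ e        rewrite e = trans (∧-identityʳ _) (proj₂ (<ᵇ-side s side))
    ... | inj₂ (inj₁ e) rewrite e = refl
    ... | inj₂ (inj₂ e) rewrite e = trans (∧-identityʳ _) (proj₁ (<ᵇ-side s side))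

  data Offset : Set where
    a≤x-2 a≡x-1 a≡x a≡x+1 a≥x+2 : Offset

  OffsetOf : ℕ → ℕ → Offset → Set
  OffsetOf x a a≤x-2 = suc (suc a) ≤ x
  OffsetOf x a a≡x-1 = x ≡ suc a
  OffsetOf x a a≡x   = a ≡ x
  OffsetOf x a a≡x+1 = a ≡ suc x
  OffsetOf x a a≥x+2 = suc (suc x) ≤ a

  offset : ∀ x a → Σ Offset (OffsetOf x a)
  offset x a with ℕ.compare x a
  ... | ℕ.less .x zero     = a≡x+1 , cong suc (ℕP.+-identityʳ x)
  ... | ℕ.less .x (suc k)  = a≥x+2 , s≤s (ℕP.m<m+n x ℕP.0<1+n)
  ... | ℕ.equal .x         = a≡x , refl
  ... | ℕ.greater .a zero  = a≡x-1 , cong suc (ℕP.+-identityʳ a)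
  ... | ℕ.greater .a (suc k) = a≤x-2 , s≤s (ℕP.m<m+n a ℕP.0<1+n)

  side⁺ side⁰ side⁻ : Offset → Side
  side⁺ a≡x+1 = level
  side⁺ a≥x+2 = above
  side⁺ _     = below
  side⁰ a≡x   = level
  side⁰ a≡x+1 = above
  side⁰ a≥x+2 = above
  side⁰ _     = below
  side⁻ a≤x-2 = below
  side⁻ a≡x-1 = level
  side⁻ _     = above

  side⁺-spec : ∀ {x a} o → OffsetOf x a o → SideOf (suc x) a (side⁺ o)
  side⁺-spec a≤x-2 p    = ℕP.<-trans (ℕP.n<1+n _) (ℕP.m<n⇒m<1+n p)
  side⁺-spec a≡x-1 refl = ℕP.m<n⇒m<1+n (ℕP.n<1+n _)
  side⁺-spec a≡x   refl = ℕP.n<1+n _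
  side⁺-spec a≡x+1 e    = e
  side⁺-spec a≥x+2 p    = p

  side⁰-spec : ∀ {x a} o → OffsetOf x a o → SideOf x a (side⁰ o)
  side⁰-spec a≤x-2 p    = ℕP.<-trans (ℕP.n<1+n _) p
  side⁰-spec a≡x-1 refl = ℕP.n<1+n _
  side⁰-spec a≡x   e    = e
  side⁰-spec a≡x+1 refl = ℕP.n<1+n _
  side⁰-spec a≥x+2 p    = ℕP.<-trans (ℕP.n<1+n _) p

  side⁻-spec : ∀ {x a} o → OffsetOf (suc x) a o → SideOf x a (side⁻ o)
  side⁻-spec a≤x-2 (s≤s p) = p
  side⁻-spec a≡x-1 refl    = refl
  side⁻-spec a≡x   refl    = ℕP.n<1+n _
  side⁻-spec a≡x+1 refl    = ℕP.m<n⇒m<1+n (ℕP.n<1+n _)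
  side⁻-spec a≥x+2 p       = ℕP.<-trans (ℕP.n<1+n _) (ℕP.<-trans (ℕP.n<1+n _) p)

  isPV-side⁺ : ∀ {x a} o → OffsetOf x a o →
               isPV (suc x) a [] ≡ admissible (next (residue x)) (residue a) (side⁺ o)
  isPV-side⁺ {x} {a} o off =
    trans (isPV-pair (suc x) a (side⁺ o) (side⁺-spec o off))
          (cong (λ i → admissible i (residue a) (side⁺ o)) (residue-suc x))

  isPV-side⁰ : ∀ {x a} o → OffsetOf x a o → isPV x a [] ≡ admissible (residue x) (residue a) (side⁰ o)
  isPV-side⁰ {x} {a} o off = isPV-pair x a (side⁰ o) (side⁰-spec o off)

  isPV-side⁻ : ∀ {x a} o → OffsetOf (suc x) a o →
               isPV x a [] ≡ admissible (prev (residue (suc x))) (residue a) (side⁻ o)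
  isPV-side⁻ {x} {a} o off =
    trans (isPV-pair x a (side⁻ o) (side⁻-spec o off))
          (cong (λ i → admissible i (residue a) (side⁻ o)) (prev-residue-suc x))

  bit : Bool → ℕ
  bit true  = 1
  bit false = 0

  data Sign : Set where
    plus minus : Sign

  carrySign : Residue → Sign
  carrySign r2 = minus
  carrySign _  = plus

  positives negatives : List (Sign × Bool) → ℕ
  positives []                  = 0
  positives ((plus , true) ∷ l) = suc (positives l)
  positives (_ ∷ l)             = positives l
  negatives []                   = 0
  negatives ((minus , true) ∷ l) = suc (negatives l)
  negatives (_ ∷ l)              = negatives l

  balanced : List (Sign × Bool) → Bool → Bool
  balanced l t = positives l ≡ᵇ negatives l ℕ.+ bit t

  -- The up, flat and down term of row x of the transfer matrix applied to a signed peak-valley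
  -- column with index a; `top` and `bottom` record x = K and x = 0.
  transferTerms : Residue → Residue → Offset → Bool → Bool → List (Sign × Bool)
  transferTerms i j o top bottom =
      (carrySign i , not top ∧ admissible (next i) j (side⁺ o))
    ∷ (minus , admissible i j (side⁰ o))
    ∷ (carrySign (prev i) , not bottom ∧ admissible (prev i) j (side⁻ o))
    ∷ []

  sameResidue : Residue → Residue → Bool
  sameResidue r0 r0 = true
  sameResidue r1 r1 = true
  sameResidue r2 r2 = true
  sameResidue _  _  = false

  residuesFit : Residue → Residue → Offset → Bool
  residuesFit i j a≡x-1 = sameResidue i (next j)
  residuesFit i j a≡x   = sameResidue i j
  residuesFit i j a≡x+1 = sameResidue j (next i)
  residuesFit i j _     = true

  -- The data that actually occur for 0 ≤ x, a ≤ K with K ≡ 2 (mod 3).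
  consistent : Residue → Residue → Offset → Bool → Bool → Bool
  consistent i j o top bottom =
    residuesFit i j o
    ∧ (not top ∨ (sameResidue i r2 ∧ not (isAbove (side⁰ o))))
    ∧ (not bottom ∨ (sameResidue i r0 ∧ not (isBelow (side⁰ o))))

  record Enumeration (A : Set) : Set where
    field
      elements : List A
      complete : ∀ x → x ∈ elements

  every : ∀ {A} → Enumeration A → (A → Bool) → Bool
  every E p = all p (Enumeration.elements E)

  every-sound : ∀ {A} (E : Enumeration A) p → T (every E p) → ∀ x → T (p x)
  every-sound E p h x = lookup (all⁺ p (Enumeration.elements E) h) (Enumeration.complete E x)

  residues : Enumeration Residue
  residues = record { elements = r0 ∷ r1 ∷ r2 ∷ [] ; complete = λ where
    r0 → here refl
    r1 → there (here refl)
    r2 → there (there (here refl)) }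

  offsets : Enumeration Offset
  offsets = record { elements = a≤x-2 ∷ a≡x-1 ∷ a≡x ∷ a≡x+1 ∷ a≥x+2 ∷ [] ; complete = λ where
    a≤x-2 → here refl
    a≡x-1 → there (here refl)
    a≡x   → there (there (here refl))
    a≡x+1 → there (there (there (here refl)))
    a≥x+2 → there (there (there (there (here refl)))) }

  booleans : Enumeration Bool
  booleans = record { elements = false ∷ true ∷ [] ; complete = λ where
    false → here refl
    true  → there (here refl) }

  _⊗_ : ∀ {A B} → Enumeration A → Enumeration B → Enumeration (A × B)
  E ⊗ E′ = record
    { elements = cartesianProduct (Enumeration.elements E) (Enumeration.elements E′)
    ; complete = λ (x , y) → ∈-cartesianProduct⁺ (Enumeration.complete E x) (Enumeration.complete E′ y) }
  infixr 4 _⊗_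

  transferTerms-balanced : ∀ i j o top bottom → T (consistent i j o top bottom) →
                           T (balanced (transferTerms i j o top bottom) (isLevel (side⁰ o)))
  transferTerms-balanced i j o top bottom =
    -- `check` is verified by evaluation on all 180 configurations
    implication (every-sound (residues ⊗ residues ⊗ offsets ⊗ booleans ⊗ booleans) check _
                             (i , j , o , top , bottom))
    where
    check : Residue × Residue × Offset × Bool × Bool → Bool
    check (i , j , o , top , bottom) =
      not (consistent i j o top bottom) ∨ balanced (transferTerms i j o top bottom) (isLevel (side⁰ o))
    implication : ∀ {a b} → T (not a ∨ b) → T a → T b
    implication {true} h _ = h

  sameResidue-refl : ∀ i → T (sameResidue i i)
  sameResidue-refl r0 = _
  sameResidue-refl r1 = _
  sameResidue-refl r2 = _

  residuesFit-offset : ∀ {x a} o → OffsetOf x a o → T (residuesFit (residue x) (residue a) o)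
  residuesFit-offset             a≤x-2 _    = _
  residuesFit-offset {a = a}     a≡x-1 refl =
    subst (λ i → T (sameResidue i (next (residue a)))) (sym (residue-suc a)) (sameResidue-refl _)
  residuesFit-offset {x}         a≡x   refl = sameResidue-refl (residue x)
  residuesFit-offset {x}         a≡x+1 refl =
    subst (λ i → T (sameResidue i (next (residue x)))) (sym (residue-suc x)) (sameResidue-refl _)
  residuesFit-offset             a≥x+2 _    = _

  consistent-offset : ∀ {K x a} o → residue K ≡ r2 → x ≤ K → a ≤ K → OffsetOf x a o →
                      T (consistent (residue x) (residue a) o (K <ᵇ suc x) (x ≡ᵇ 0))
  consistent-offset {K} {x} {a} o K≡2 x≤K a≤K off =
    Equivalence.from T-∧ (residuesFit-offset o off , Equivalence.from T-∧ (top , bottom x off))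
    where
    top : T (not (K <ᵇ suc x) ∨ (sameResidue (residue x) r2 ∧ not (isAbove (side⁰ o))))
    top with ℕP.m≤n⇒m<n∨m≡n x≤K
    ... | inj₁ x<K rewrite <ᵇ-false x<K = _
    ... | inj₂ refl rewrite <ᵇ-true (ℕP.n<1+n x) | K≡2 = notAbove o a≤K off
      where
      notAbove : ∀ {a} o → a ≤ x → OffsetOf x a o → T (not (isAbove (side⁰ o)))
      notAbove a≤x-2 _   _    = _
      notAbove a≡x-1 _   _    = _
      notAbove a≡x   _   _    = _
      notAbove a≡x+1 a≤x refl = ℕP.<-irrefl refl a≤x
      notAbove a≥x+2 a≤x p    = ℕP.<-irrefl refl (ℕP.≤-trans (ℕP.≤-trans (ℕP.n≤1+n _) p) a≤x)
    bottom : ∀ x → OffsetOf x a o → T (not (x ≡ᵇ 0) ∨ (sameResidue (residue x) r0 ∧ not (isBelow (side⁰ o))))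
    bottom (suc _) _ = _
    bottom zero off = notBelow o off
      where
      notBelow : ∀ o → OffsetOf 0 a o → T (not (isBelow (side⁰ o)))
      notBelow a≡x   _ = _
      notBelow a≡x+1 _ = _
      notBelow a≥x+2 _ = _

module IntegerShifts where
  open import Relation.Binary.PropositionalEquality

  ℤ-suc-+ : ∀ A m → ℤ.suc (A ℤ.+ ℤ.+ m) ≡ A ℤ.+ ℤ.+ suc m
  ℤ-suc-+ A m = lemma A (ℤ.+ m)
    where
    lemma : ∀ A M → ℤ.1ℤ ℤ.+ (A ℤ.+ M) ≡ A ℤ.+ (ℤ.1ℤ ℤ.+ M)
    lemma = solve-∀

  ℤ-pred-+-suc : ∀ A m → ℤ.pred A ℤ.+ ℤ.+ suc m ≡ A ℤ.+ ℤ.+ m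
  ℤ-pred-+-suc A m = lemma A (ℤ.+ m)
    where
    lemma : ∀ A M → (ℤ.-1ℤ ℤ.+ A) ℤ.+ (ℤ.1ℤ ℤ.+ M) ≡ A ℤ.+ M
    lemma = solve-∀

  ℤ-+-∸ : ∀ A {d j} → j ≤ d → A ℤ.+ ℤ.+ d ℤ.- ℤ.+ j ≡ A ℤ.+ ℤ.+ (d ∸ j)
  ℤ-+-∸ A {d} {j} j≤d =
    trans (ℤP.+-assoc A (ℤ.+ d) (ℤ.- ℤ.+ j)) (cong (ℤ._+_ A) (trans (ℤP.m-n≡m⊖n d j) (ℤP.⊖-≥ j≤d)))

  ℤ-+-suc-∸ : ∀ A d → A ℤ.+ ℤ.+ d ℤ.- ℤ.+ suc d ≡ ℤ.pred A
  ℤ-+-suc-∸ A d = lemma A (ℤ.+ d)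
    where
    lemma : ∀ A D → (A ℤ.+ D) ℤ.- (ℤ.1ℤ ℤ.+ D) ≡ ℤ.-1ℤ ℤ.+ A
    lemma = solve-∀

open Combinatorics
open IntegerShifts

module _ {c ℓ : Level} (F : Field c ℓ) where
  open Field F
  open import Relation.Binary.Reasoning.Setoid setoid
  open import Algebra.Properties.Ring ring
    using (-‿distribˡ-*; -‿distribʳ-*; -‿involutive; -1*x≈-x; -‿+-comm; +-cancelʳ; x∙y⁻¹≈ε⇒x≈y)
  open import Algebra.Properties.CommutativeSemigroup *-commutativeSemigroup
    using (interchange; x∙yz≈y∙xz)
  open import Algebra.Properties.CommutativeSemigroup +-commutativeSemigroup
    using () renaming (interchange to +-interchange)
  open import Algebra.Definitions.RawMonoid +-rawMonoid using () renaming (_×_ to _·_)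
  open import Algebra.Properties.Monoid.Mult +-monoid using (×-homo-+)
  open CommutativeMonoidSolver *-commutativeMonoid using (Expr; prove; var; _⊕_)

  private
    x₀ : ∀ {n} → Expr (1 ℕ.+ n)
    x₀ = var (# 0)
    x₁ : ∀ {n} → Expr (2 ℕ.+ n)
    x₁ = var (# 1)
    x₂ : ∀ {n} → Expr (3 ℕ.+ n)
    x₂ = var (# 2)
    x₃ : ∀ {n} → Expr (4 ℕ.+ n)
    x₃ = var (# 3)
    x₄ : ∀ {n} → Expr (5 ℕ.+ n)
    x₄ = var (# 4)
    x₅ : ∀ {n} → Expr (6 ℕ.+ n)
    x₅ = var (# 5)
    x₆ : ∀ {n} → Expr (7 ℕ.+ n)
    x₆ = var (# 6)
    x₇ : ∀ {n} → Expr (8 ℕ.+ n)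
    x₇ = var (# 7)

  private variable
    ℓa : Level
    A B : Set ℓa

  ∑ : (A → Carrier) → List A → Carrier
  ∑ f []      = 0#
  ∑ f (x ∷ l) = f x + ∑ f l

  ∑-cong : {f g : A → Carrier} (l : List A) → (∀ x → f x ≈ g x) → ∑ f l ≈ ∑ g l
  ∑-cong []      e = refl
  ∑-cong (x ∷ l) e = +-cong (e x) (∑-cong l e)

  ∑-+ : (f g : A → Carrier) (l : List A) → ∑ (λ x → f x + g x) l ≈ ∑ f l + ∑ g l
  ∑-+ f g []      = sym (+-identityˡ 0#)
  ∑-+ f g (x ∷ l) = trans (+-cong refl (∑-+ f g l)) (+-interchange _ _ _ _)

  ∑-*ˡ : (a : Carrier) (f : A → Carrier) (l : List A) → ∑ (λ x → a * f x) l ≈ a * ∑ f l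
  ∑-*ˡ a f []      = sym (zeroʳ a)
  ∑-*ˡ a f (x ∷ l) = trans (+-cong refl (∑-*ˡ a f l)) (sym (distribˡ a (f x) (∑ f l)))

  ∑-zero : (l : List A) → ∑ (λ _ → 0#) l ≈ 0#
  ∑-zero []      = refl
  ∑-zero (x ∷ l) = trans (+-identityˡ _) (∑-zero l)

  ∑-comm : (f : A → B → Carrier) (l : List A) (m : List B) →
           ∑ (λ x → ∑ (f x) m) l ≈ ∑ (λ y → ∑ (λ x → f x y) l) m
  ∑-comm f []      m = sym (∑-zero m)
  ∑-comm f (x ∷ l) m = trans (+-cong refl (∑-comm f l m)) (sym (∑-+ (f x) (λ y → ∑ (λ x → f x y) l) m))

  ∑-++ : (f : A → Carrier) (l m : List A) → ∑ f (l ++ m) ≈ ∑ f l + ∑ f m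
  ∑-++ f []      m = sym (+-identityˡ _)
  ∑-++ f (x ∷ l) m = trans (+-cong refl (∑-++ f l m)) (sym (+-assoc _ _ _))

  ∑-concatMap : (f : B → Carrier) (h : A → List B) (l : List A) →
                ∑ f (concatMap h l) ≈ ∑ (λ x → ∑ f (h x)) l
  ∑-concatMap f h []      = refl
  ∑-concatMap f h (x ∷ l) = trans (∑-++ f (h x) (concatMap h l)) (+-cong refl (∑-concatMap f h l))

  ∑-map : (f : B → Carrier) (g : A → B) (l : List A) → ∑ f (map g l) ≈ ∑ (λ x → f (g x)) l
  ∑-map f g []      = refl
  ∑-map f g (x ∷ l) = +-cong refl (∑-map f g l)

  sumR≈∑ : (l : List Carrier) → sumR F l ≈ ∑ (λ x → x) l
  sumR≈∑ []      = refl
  sumR≈∑ (x ∷ l) = +-cong refl (sumR≈∑ l)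

  sumR-concatMap : (h : A → List Carrier) (l : List A) →
                   sumR F (concatMap h l) ≈ ∑ (λ x → sumR F (h x)) l
  sumR-concatMap h l = begin
    sumR F (concatMap h l)           ≈⟨ sumR≈∑ (concatMap h l) ⟩
    ∑ (λ x → x) (concatMap h l)      ≈⟨ ∑-concatMap (λ x → x) h l ⟩
    ∑ (λ x → ∑ (λ y → y) (h x)) l    ≈⟨ ∑-cong l (λ x → sym (sumR≈∑ (h x))) ⟩
    ∑ (λ x → sumR F (h x)) l         ∎

  ∑-upTo-suc : (f : ℕ → Carrier) (n : ℕ) → ∑ f (upTo (suc n)) ≈ ∑ f (upTo n) + (f n + 0#)
  ∑-upTo-suc f n = trans (reflexive (≡.cong (∑ f) (≡.sym (ListP.upTo-∷ʳ n)))) (∑-++ f (upTo n) [ n ])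

  ∑-upTo-cong : {f g : ℕ → Carrier} (n : ℕ) → (∀ a → a < n → f a ≈ g a) → ∑ f (upTo n) ≈ ∑ g (upTo n)
  ∑-upTo-cong zero    e = refl
  ∑-upTo-cong {f} {g} (suc n) e = begin
    ∑ f (upTo (suc n))         ≈⟨ ∑-upTo-suc f n ⟩
    ∑ f (upTo n) + (f n + 0#)
      ≈⟨ +-cong (∑-upTo-cong n (λ a a<n → e a (ℕP.m<n⇒m<1+n a<n))) (+-cong (e n ℕP.≤-refl) refl) ⟩
    ∑ g (upTo n) + (g n + 0#)  ≈⟨ sym (∑-upTo-suc g n) ⟩
    ∑ g (upTo (suc n))         ∎

  𝟙 : Bool → Carrier
  𝟙 true  = 1#
  𝟙 false = 0#

  𝟙-false : ∀ {b} (y : Carrier) → b ≡ false → 𝟙 b * y ≈ 0#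
  𝟙-false y ≡.refl = zeroˡ y

  𝟙-true : ∀ {b} (y : Carrier) → b ≡ true → 𝟙 b * y ≈ y
  𝟙-true y ≡.refl = *-identityˡ y

  ∑-δ : (f : ℕ → Carrier) (n x : ℕ) → x < n → ∑ (λ a → 𝟙 (x ≡ᵇ a) * f a) (upTo n) ≈ f x
  ∑-δ f (suc n) x x<1+n with ℕP.m≤n⇒m<n∨m≡n (ℕP.≤-pred x<1+n)
  ... | inj₁ x<n = begin
    ∑ δf (upTo (suc n))
      ≈⟨ ∑-upTo-suc δf n ⟩
    ∑ δf (upTo n) + (δf n + 0#)
      ≈⟨ +-cong (∑-δ f n x x<n) (trans (+-identityʳ _) (𝟙-false (f n) (≡ᵇ-< x<n))) ⟩
    f x + 0#
      ≈⟨ +-identityʳ _ ⟩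
    f x                          ∎
    where δf = λ a → 𝟙 (x ≡ᵇ a) * f a
  ... | inj₂ ≡.refl = begin
    ∑ δf (upTo (suc x))          ≈⟨ ∑-upTo-suc δf x ⟩
    ∑ δf (upTo x) + (δf x + 0#)  ≈⟨ +-cong earlier (+-identityʳ _) ⟩
    0# + δf x                    ≈⟨ +-identityˡ _ ⟩
    δf x                         ≈⟨ 𝟙-true (f x) (≡ᵇ-refl x) ⟩
    f x                          ∎
    where
    δf = λ a → 𝟙 (x ≡ᵇ a) * f a
    earlier : ∑ δf (upTo x) ≈ 0#
    earlier = trans (∑-upTo-cong x (λ a a<x → 𝟙-false (f a) (≡ᵇ-> a<x))) (∑-zero (upTo x))

  ⟦_⟧ : Sign → Carrier
  ⟦ plus ⟧  = 1#
  ⟦ minus ⟧ = - 1#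

  ⟦⟧-square : ∀ s → ⟦ s ⟧ * ⟦ s ⟧ ≈ 1#
  ⟦⟧-square plus  = *-identityˡ 1#
  ⟦⟧-square minus = begin
    - 1# * - 1#    ≈⟨ -1*x≈-x (- 1#) ⟩
    - (- 1#)       ≈⟨ -‿involutive 1# ⟩
    1#             ∎

  signed : Sign × Bool → Carrier
  signed (s , b) = ⟦ s ⟧ * 𝟙 b

  ∑-signed : ∀ l → ∑ signed l + negatives l · 1# ≈ positives l · 1#
  ∑-signed []                   = +-identityˡ 0#
  ∑-signed ((plus , true) ∷ l)  = begin
    (1# * 1# + ∑ signed l) + negatives l · 1#  ≈⟨ +-assoc _ _ _ ⟩
    1# * 1# + (∑ signed l + negatives l · 1#)  ≈⟨ +-cong (*-identityˡ 1#) (∑-signed l) ⟩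
    1# + positives l · 1#                      ∎
  ∑-signed ((minus , true) ∷ l) = begin
    (- 1# * 1# + ∑ signed l) + (1# + negatives l · 1#)  ≈⟨ +-cong (+-cong (*-identityʳ (- 1#)) refl) refl ⟩
    (- 1# + ∑ signed l) + (1# + negatives l · 1#)       ≈⟨ cancel 1# (∑ signed l) _ ⟩
    ∑ signed l + negatives l · 1#                       ≈⟨ ∑-signed l ⟩
    positives l · 1#                                    ∎
    where
    cancel : ∀ a x y → (- a + x) + (a + y) ≈ x + y
    cancel a x y = trans (+-interchange (- a) x a y) (trans (+-cong (-‿inverseˡ a) refl) (+-identityˡ _))
  ∑-signed ((plus , false) ∷ l)  = trans (+-cong (trans (+-cong (zeroʳ 1#) refl) (+-identityˡ _)) refl)
                                         (∑-signed l)
  ∑-signed ((minus , false) ∷ l) = trans (+-cong (trans (+-cong (zeroʳ (- 1#)) refl) (+-identityˡ _)) refl)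
                                         (∑-signed l)

  balanced-sound : ∀ l t → T (balanced l t) → ∑ signed l ≈ 𝟙 t
  balanced-sound l t h = +-cancelʳ (negatives l · 1#) _ _ (begin
    ∑ signed l + negatives l · 1#               ≈⟨ ∑-signed l ⟩
    positives l · 1#
      ≈⟨ reflexive (≡.cong (_· 1#) (ℕP.≡ᵇ⇒≡ (positives l) (negatives l ℕ.+ bit t) h)) ⟩
    (negatives l ℕ.+ bit t) · 1#              ≈⟨ ×-homo-+ 1# (negatives l) (bit t) ⟩
    negatives l · 1# + bit t · 1#             ≈⟨ +-comm _ _ ⟩
    bit t · 1# + negatives l · 1#             ≈⟨ +-cong (bit-𝟙 t) refl ⟩
    𝟙 t + negatives l · 1#                      ∎)
    where
    bit-𝟙 : ∀ t → bit t · 1# ≈ 𝟙 t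
    bit-𝟙 true  = +-identityʳ 1#
    bit-𝟙 false = refl

  negOnePow-+ : ∀ m n → negOnePow F (m ℕ.+ n) ≈ negOnePow F m * negOnePow F n
  negOnePow-+ zero    n = sym (*-identityˡ _)
  negOnePow-+ (suc m) n = trans (*-cong refl (negOnePow-+ m n)) (sym (*-assoc _ _ _))

  negOnePow-square : ∀ m → negOnePow F m * negOnePow F m ≈ 1#
  negOnePow-square zero    = *-identityˡ 1#
  negOnePow-square (suc m) = begin
    (- 1# * negOnePow F m) * (- 1# * negOnePow F m)   ≈⟨ interchange _ _ _ _ ⟩
    (- 1# * - 1#) * (negOnePow F m * negOnePow F m)   ≈⟨ *-cong (⟦⟧-square minus) (negOnePow-square m) ⟩
    1# * 1#                                           ≈⟨ *-identityˡ 1# ⟩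
    1#                                                ∎

  negOnePow-carry : ∀ i → negOnePow F (carry i) ≈ ⟦ carrySign i ⟧
  negOnePow-carry r0 = refl
  negOnePow-carry r1 = refl
  negOnePow-carry r2 = *-identityʳ (- 1#)

  negOnePow-/3-suc : ∀ x → negOnePow F (suc x / 3) ≈ ⟦ carrySign (residue x) ⟧ * negOnePow F (x / 3)
  negOnePow-/3-suc x = begin
    negOnePow F (suc x / 3)                               ≈⟨ reflexive (≡.cong (negOnePow F) (/3-suc x)) ⟩
    negOnePow F (carry (residue x) ℕ.+ x / 3)             ≈⟨ negOnePow-+ (carry (residue x)) (x / 3) ⟩
    negOnePow F (carry (residue x)) * negOnePow F (x / 3) ≈⟨ *-cong (negOnePow-carry (residue x)) refl ⟩
    ⟦ carrySign (residue x) ⟧ * negOnePow F (x / 3)       ∎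

  negOnePow-/3 : ∀ x → negOnePow F (x / 3) ≈ ⟦ carrySign (residue x) ⟧ * negOnePow F (suc x / 3)
  negOnePow-/3 x = begin
    negOnePow F (x / 3)            ≈⟨ sym (*-identityˡ _) ⟩
    1# * negOnePow F (x / 3)       ≈⟨ *-cong (sym (⟦⟧-square σ)) refl ⟩
    (⟦ σ ⟧ * ⟦ σ ⟧) * negOnePow F (x / 3)   ≈⟨ *-assoc _ _ _ ⟩
    ⟦ σ ⟧ * (⟦ σ ⟧ * negOnePow F (x / 3))   ≈⟨ *-cong refl (sym (negOnePow-/3-suc x)) ⟩
    ⟦ σ ⟧ * negOnePow F (suc x / 3)         ∎
    where σ = carrySign (residue x)

  -- The coefficient list (a₀, a₁, …) acts on f : ℤ → Carrier as Σ aᵢ Eⁱ, E the shift N ↦ N + 1.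
  evalShift : List Carrier → (ℤ → Carrier) → ℤ → Carrier
  evalShift []      f N = 0#
  evalShift (a ∷ p) f N = a * f N + evalShift p f (ℤ.suc N)

  evalShift-cong : ∀ p {f g : ℤ → Carrier} → (∀ M → f M ≈ g M) → ∀ N → evalShift p f N ≈ evalShift p g N
  evalShift-cong []      e N = refl
  evalShift-cong (a ∷ p) e N = +-cong (*-cong refl (e N)) (evalShift-cong p e (ℤ.suc N))

  evalShift-zero : ∀ p N → evalShift p (λ _ → 0#) N ≈ 0#
  evalShift-zero []      N = refl
  evalShift-zero (a ∷ p) N = trans (+-cong (zeroʳ a) (evalShift-zero p (ℤ.suc N))) (+-identityˡ 0#)

  evalShift-+ : ∀ p f g N → evalShift p (λ M → f M + g M) N ≈ evalShift p f N + evalShift p g N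
  evalShift-+ []      f g N = sym (+-identityˡ 0#)
  evalShift-+ (a ∷ p) f g N =
    trans (+-cong (distribˡ a (f N) (g N)) (evalShift-+ p f g (ℤ.suc N))) (+-interchange _ _ _ _)

  evalShift-* : ∀ p b f N → evalShift p (λ M → b * f M) N ≈ b * evalShift p f N
  evalShift-* []      b f N = sym (zeroʳ b)
  evalShift-* (a ∷ p) b f N =
    trans (+-cong (x∙yz≈y∙xz a b (f N)) (evalShift-* p b f (ℤ.suc N))) (sym (distribˡ b _ _))

  evalShift-- : ∀ p f g N → evalShift p (λ M → f M - g M) N ≈ evalShift p f N - evalShift p g N
  evalShift-- p f g N = begin
    evalShift p (λ M → f M - g M) N
      ≈⟨ evalShift-+ p f (λ M → - g M) N ⟩
    evalShift p f N + evalShift p (λ M → - g M) N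
      ≈⟨ +-cong refl (evalShift-cong p (λ M → sym (-1*x≈-x (g M))) N) ⟩
    evalShift p f N + evalShift p (λ M → - 1# * g M) N
      ≈⟨ +-cong refl (evalShift-* p (- 1#) g N) ⟩
    evalShift p f N + - 1# * evalShift p g N
      ≈⟨ +-cong refl (-1*x≈-x _) ⟩
    evalShift p f N - evalShift p g N               ∎

  evalShift-suc : ∀ p f N → evalShift p (λ M → f (ℤ.suc M)) N ≈ evalShift p f (ℤ.suc N)
  evalShift-suc []      f N = refl
  evalShift-suc (a ∷ p) f N = +-cong refl (evalShift-suc p f (ℤ.suc N))

  evalShift-translate : ∀ p f (D N : ℤ) → evalShift p (λ M → f (M ℤ.+ D)) N ≈ evalShift p f (N ℤ.+ D)
  evalShift-translate []      f D N = refl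
  evalShift-translate (a ∷ p) f D N = +-cong refl (begin
    evalShift p (λ M → f (M ℤ.+ D)) (ℤ.suc N)  ≈⟨ evalShift-translate p f D (ℤ.suc N) ⟩
    evalShift p f (ℤ.suc N ℤ.+ D)              ≈⟨ reflexive (≡.cong (evalShift p f) (ℤP.+-assoc ℤ.1ℤ N D)) ⟩
    evalShift p f (ℤ.suc (N ℤ.+ D))            ∎)

  evalShift-sumFrom1 : ∀ p d (cf : ℕ → Carrier) (f : ℤ → Carrier) N →
    evalShift p (λ M → sumFrom1 F d (λ j → cf j * f (M ℤ.- ℤ.+ j))) N
      ≈ sumFrom1 F d (λ j → cf j * evalShift p f (N ℤ.- ℤ.+ j))
  evalShift-sumFrom1 p zero    cf f N = evalShift-zero p N
  evalShift-sumFrom1 p (suc d) cf f N = trans (evalShift-+ p _ _ N) (+-cong (evalShift-sumFrom1 p d cf f N)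
    (trans (evalShift-* p (cf (suc d)) _ N) (*-cong refl (evalShift-translate p f (ℤ.- ℤ.+ suc d) N))))

  _⊞_ : List Carrier → List Carrier → List Carrier
  []      ⊞ q       = q
  (a ∷ p) ⊞ []      = a ∷ p
  (a ∷ p) ⊞ (b ∷ q) = (a + b) ∷ (p ⊞ q)

  scale : Carrier → List Carrier → List Carrier
  scale a = map (a *_)

  constantTerm : List Carrier → Carrier
  constantTerm []      = 0#
  constantTerm (a ∷ _) = a

  evalShift-⊞ : ∀ p q f N → evalShift (p ⊞ q) f N ≈ evalShift p f N + evalShift q f N
  evalShift-⊞ []      q       f N = sym (+-identityˡ _)
  evalShift-⊞ (a ∷ p) []      f N = sym (+-identityʳ _)
  evalShift-⊞ (a ∷ p) (b ∷ q) f N =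
    trans (+-cong (distribʳ (f N) a b) (evalShift-⊞ p q f (ℤ.suc N))) (+-interchange _ _ _ _)

  evalShift-scale : ∀ a p f N → evalShift (scale a p) f N ≈ a * evalShift p f N
  evalShift-scale a []      f N = sym (zeroʳ a)
  evalShift-scale a (b ∷ p) f N =
    trans (+-cong (*-assoc a b (f N)) (evalShift-scale a p f (ℤ.suc N))) (sym (distribˡ a _ _))

  constantTerm-⊞ : ∀ p q → constantTerm (p ⊞ q) ≈ constantTerm p + constantTerm q
  constantTerm-⊞ []      q       = sym (+-identityˡ _)
  constantTerm-⊞ (a ∷ p) []      = sym (+-identityʳ _)
  constantTerm-⊞ (a ∷ p) (b ∷ q) = refl

  constantTerm-scale : ∀ a p → constantTerm (scale a p) ≈ a * constantTerm p
  constantTerm-scale a []      = sym (zeroʳ a)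
  constantTerm-scale a (b ∷ p) = refl

  AgreeFrom : (ℤ → Carrier) → (ℤ → Carrier) → ℤ → Set ℓ
  AgreeFrom f g A = ∀ m → f (A ℤ.+ ℤ.+ m) ≈ g (A ℤ.+ ℤ.+ m)

  VanishesFrom : (ℤ → Carrier) → ℤ → Set ℓ
  VanishesFrom f = AgreeFrom f (λ _ → 0#)

  evalShift-agreeFrom : ∀ p {f g A} → AgreeFrom f g A → evalShift p f A ≈ evalShift p g A
  evalShift-agreeFrom []      e = refl
  evalShift-agreeFrom (a ∷ p) {f} {g} {A} e = +-cong (*-cong refl here) (evalShift-agreeFrom p later)
    where
    here : f A ≈ g A
    here = ≡.subst (λ M → f M ≈ g M) (ℤP.+-identityʳ A) (e 0)
    later : AgreeFrom f g (ℤ.suc A)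
    later m = ≡.subst (λ M → f M ≈ g M) (≡.sym (≡.trans (ℤP.+-assoc ℤ.1ℤ A (ℤ.+ m)) (ℤ-suc-+ A m)))
                      (e (suc m))

  evalShift-vanishing : ∀ p {f A} → VanishesFrom f A → evalShift p f A ≈ 0#
  evalShift-vanishing p {A = A} v = trans (evalShift-agreeFrom p v) (evalShift-zero p A)

  vanishesFrom-pred : ∀ {f A} → VanishesFrom f A → f (ℤ.pred A) ≈ 0# → VanishesFrom f (ℤ.pred A)
  vanishesFrom-pred {f} {A} v h zero    = trans (reflexive (≡.cong f (ℤP.+-identityʳ (ℤ.pred A)))) h
  vanishesFrom-pred {f} {A} v h (suc m) = trans (reflexive (≡.cong f (ℤ-pred-+-suc A m))) (v m)

  vanishing-backwards : ∀ {f} → (∀ A → VanishesFrom f A → VanishesFrom f (ℤ.pred A)) →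
                        ∀ d → VanishesFrom f (ℤ.+ d) → ∀ N → f N ≈ 0#
  vanishing-backwards {f} step d v = everywhere
    where
    fromZero : ∀ d → VanishesFrom f (ℤ.+ d) → VanishesFrom f (ℤ.+ 0)
    fromZero zero    v = v
    fromZero (suc d) v = fromZero d (step (ℤ.+ suc d) v)
    fromNegative : ∀ n → VanishesFrom f ℤ.-[1+ n ]
    fromNegative zero    = step (ℤ.+ 0) (fromZero d v)
    fromNegative (suc n) = step ℤ.-[1+ n ] (fromNegative n)
    everywhere : ∀ N → f N ≈ 0#
    everywhere (ℤ.+ n)    = fromZero d v n
    everywhere ℤ.-[1+ n ] = fromNegative n 0

  *-cancel-≉0 : ∀ {a x} → ¬ a ≈ 0# → a * x ≈ 0# → x ≈ 0#
  *-cancel-≉0 {a} {x} a≉0 ax≈0 = begin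
    x               ≈⟨ sym (*-identityˡ x) ⟩
    1# * x          ≈⟨ *-cong (sym (trans (*-comm b a) ab≈1)) refl ⟩
    (b * a) * x     ≈⟨ *-assoc b a x ⟩
    b * (a * x)     ≈⟨ *-cong refl ax≈0 ⟩
    b * 0#          ≈⟨ zeroʳ b ⟩
    0#              ∎
    where
    b = proj₁ (inverse a a≉0)
    ab≈1 = proj₂ (inverse a a≉0)

  annihilated-step : ∀ {f} p → ¬ constantTerm p ≈ 0# → (∀ N → evalShift p f N ≈ 0#) →
                     ∀ A → VanishesFrom f A → VanishesFrom f (ℤ.pred A)
  annihilated-step []      a≉0 ann A v = ⊥-elim (a≉0 refl)
  annihilated-step {f} (a ∷ p) a≉0 ann A v = vanishesFrom-pred {f} {A} v (*-cancel-≉0 a≉0 (begin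
    a * f (ℤ.pred A)
      ≈⟨ sym (+-identityʳ _) ⟩
    a * f (ℤ.pred A) + 0#
      ≈⟨ +-cong refl (sym (evalShift-vanishing p v)) ⟩
    a * f (ℤ.pred A) + evalShift p f A
      ≈⟨ +-cong refl (reflexive (≡.cong (evalShift p f) (≡.sym (ℤP.suc-pred A)))) ⟩
    evalShift (a ∷ p) f (ℤ.pred A)
      ≈⟨ ann (ℤ.pred A) ⟩
    0#                                                   ∎))

  sumFrom1-zero : ∀ d {f : ℕ → Carrier} → (∀ j → 1 ≤ j → j ≤ d → f j ≈ 0#) → sumFrom1 F d f ≈ 0#
  sumFrom1-zero zero    e = refl
  sumFrom1-zero (suc d) e =
    trans (+-cong (sumFrom1-zero d (λ j 1≤j j≤d → e j 1≤j (ℕP.m≤n⇒m≤1+n j≤d))) (e (suc d) (s≤s z≤n) ℕP.≤-refl))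
          (+-identityˡ 0#)

  recurrence-step : ∀ {f d} {cf : ℕ → Carrier} → ¬ cf (suc d) ≈ 0# →
                    (∀ N → f N ≈ sumFrom1 F (suc d) (λ j → cf j * f (N ℤ.- ℤ.+ j))) →
                    ∀ A → VanishesFrom f A → VanishesFrom f (ℤ.pred A)
  recurrence-step {f} {d} {cf} cf≉0 rec A v = vanishesFrom-pred {f} {A} v (*-cancel-≉0 cf≉0 (begin
    cf (suc d) * f (ℤ.pred A)
      ≈⟨ *-cong refl (reflexive (≡.cong f (≡.sym (ℤ-+-suc-∸ A d)))) ⟩
    cf (suc d) * f (N ℤ.- ℤ.+ suc d)
      ≈⟨ sym (+-identityˡ _) ⟩
    0# + cf (suc d) * f (N ℤ.- ℤ.+ suc d)
      ≈⟨ +-cong (sym (sumFrom1-zero d earlier)) refl ⟩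
    sumFrom1 F (suc d) (λ j → cf j * f (N ℤ.- ℤ.+ j))
      ≈⟨ sym (rec N) ⟩
    f N
      ≈⟨ v d ⟩
    0#                                               ∎))
    where
    N = A ℤ.+ ℤ.+ d
    earlier : ∀ j → 1 ≤ j → j ≤ d → cf j * f (N ℤ.- ℤ.+ j) ≈ 0#
    earlier j _ j≤d = trans (*-cong refl (trans (reflexive (≡.cong f (ℤ-+-∸ A j≤d))) (v (d ∸ j)))) (zeroʳ _)

  module Jacobi (b lam : ℕ → Carrier) where

    -- P ↦ (E − b x) P − lam x P′, the three-term recurrence of the orthogonal polynomials
    nextPoly : ℕ → List Carrier → List Carrier → List Carrier
    nextPoly x p p′ = (0# ∷ p) ⊞ (scale (- b x) p ⊞ scale (- lam x) p′)

    -- (P x , P (x + 1)) with P 0 = 1 and P (-1) = 0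
    orthoPolys : ℕ → List Carrier × List Carrier
    orthoPolys zero    = 1# ∷ [] , nextPoly 0 (1# ∷ []) []
    orthoPolys (suc x) = proj₂ (orthoPolys x) , nextPoly (suc x) (proj₂ (orthoPolys x)) (proj₁ (orthoPolys x))

    evalShift-nextPoly : ∀ x p p′ f N → evalShift (nextPoly x p p′) f N
                         ≈ evalShift p f (ℤ.suc N) + ((- b x) * evalShift p f N + (- lam x) * evalShift p′ f N)
    evalShift-nextPoly x p p′ f N = begin
      evalShift (nextPoly x p p′) f N
        ≈⟨ evalShift-⊞ (0# ∷ p) (scale (- b x) p ⊞ scale (- lam x) p′) f N ⟩
      (0# * f N + evalShift p f (ℤ.suc N)) + evalShift (scale (- b x) p ⊞ scale (- lam x) p′) f N
        ≈⟨ +-cong (trans (+-cong (zeroˡ _) refl) (+-identityˡ _)) (evalShift-⊞ (scale (- b x) p) _ f N) ⟩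
      evalShift p f (ℤ.suc N) + (evalShift (scale (- b x) p) f N + evalShift (scale (- lam x) p′) f N)
        ≈⟨ +-cong refl (+-cong (evalShift-scale (- b x) p f N) (evalShift-scale (- lam x) p′ f N)) ⟩
      evalShift p f (ℤ.suc N) + ((- b x) * evalShift p f N + (- lam x) * evalShift p′ f N) ∎

    constantTerm-nextPoly : ∀ x p p′ → constantTerm (nextPoly x p p′)
                            ≈ (- b x) * constantTerm p + (- lam x) * constantTerm p′
    constantTerm-nextPoly x p p′ = begin
      constantTerm (nextPoly x p p′)
        ≈⟨ constantTerm-⊞ (0# ∷ p) (scale (- b x) p ⊞ scale (- lam x) p′) ⟩
      0# + constantTerm (scale (- b x) p ⊞ scale (- lam x) p′)
        ≈⟨ +-identityˡ _ ⟩
      constantTerm (scale (- b x) p ⊞ scale (- lam x) p′)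
        ≈⟨ constantTerm-⊞ (scale (- b x) p) _ ⟩
      constantTerm (scale (- b x) p) + constantTerm (scale (- lam x) p′)
        ≈⟨ +-cong (constantTerm-scale (- b x) p) (constantTerm-scale (- lam x) p′) ⟩
      (- b x) * constantTerm p + (- lam x) * constantTerm p′ ∎

    -- transfer is the tridiagonal matrix A on indices 0 … K with 1 above, b on and lam below the diagonal.
    module Truncated (K : ℕ) where

      upper : (ℕ → Carrier) → ℕ → Carrier
      upper z x = if K <ᵇ suc x then 0# else z (suc x)

      lower : (ℕ → Carrier) → ℕ → Carrier
      lower z zero    = 0#
      lower z (suc x) = lam (suc x) * z x

      transfer : (ℕ → Carrier) → ℕ → Carrier
      transfer z x = upper z x + (b x * z x + lower z x)

      transfer-cong : ∀ {f g} → (∀ y → f y ≈ g y) → ∀ x → transfer f x ≈ transfer g x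
      transfer-cong {f} {g} e x = +-cong upper-cong (+-cong (*-cong refl (e x)) (lower-cong x))
        where
        upper-cong : upper f x ≈ upper g x
        upper-cong with K <ᵇ suc x
        ... | true  = refl
        ... | false = e (suc x)
        lower-cong : ∀ x → lower f x ≈ lower g x
        lower-cong zero    = refl
        lower-cong (suc x) = *-cong refl (e x)

      transfer-zero : ∀ x → transfer (λ _ → 0#) x ≈ 0#
      transfer-zero x =
        trans (+-cong upper-zero (+-cong (zeroʳ _) (lower-zero x))) (trans (+-identityˡ _) (+-identityˡ _))
        where
        upper-zero : upper (λ _ → 0#) x ≈ 0#
        upper-zero with K <ᵇ suc x
        ... | true  = refl
        ... | false = refl
        lower-zero : ∀ x → lower (λ _ → 0#) x ≈ 0#
        lower-zero zero    = refl
        lower-zero (suc x) = zeroʳ _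

      transfer-+ : ∀ f g x → transfer f x + transfer g x ≈ transfer (λ y → f y + g y) x
      transfer-+ f g x = begin
        (upper f x + (b x * f x + lower f x)) + (upper g x + (b x * g x + lower g x))
          ≈⟨ +-interchange _ _ _ _ ⟩
        (upper f x + upper g x) + ((b x * f x + lower f x) + (b x * g x + lower g x))
          ≈⟨ +-cong upper-+ (trans (+-interchange _ _ _ _) (+-cong (sym (distribˡ _ _ _)) (lower-+ x))) ⟩
        transfer (λ y → f y + g y) x ∎
        where
        upper-+ : upper f x + upper g x ≈ upper (λ y → f y + g y) x
        upper-+ with K <ᵇ suc x
        ... | true  = +-identityˡ 0#
        ... | false = refl
        lower-+ : ∀ x → lower f x + lower g x ≈ lower (λ y → f y + g y) x
        lower-+ zero    = +-identityˡ 0#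
        lower-+ (suc x) = sym (distribˡ _ _ _)

      transfer-*ˡ : ∀ a f x → transfer (λ y → a * f y) x ≈ a * transfer f x
      transfer-*ˡ a f x =
        trans (+-cong upper-* (+-cong (x∙yz≈y∙xz _ _ _) (lower-* x)))
              (sym (trans (distribˡ _ _ _) (+-cong refl (distribˡ _ _ _))))
        where
        upper-* : upper (λ y → a * f y) x ≈ a * upper f x
        upper-* with K <ᵇ suc x
        ... | true  = sym (zeroʳ a)
        ... | false = refl
        lower-* : ∀ x → lower (λ y → a * f y) x ≈ a * lower f x
        lower-* zero    = sym (zeroʳ a)
        lower-* (suc x) = x∙yz≈y∙xz _ _ _

      transfer-*ʳ : ∀ a f x → transfer (λ y → f y * a) x ≈ transfer f x * a
      transfer-*ʳ a f x = trans (transfer-cong (λ y → *-comm (f y) a) x) (trans (transfer-*ˡ a f x) (*-comm a _))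

      transfer-∑ : ∀ {A : Set} (f : ℕ → A → Carrier) (l : List A) x →
                   ∑ (λ w → transfer (λ y → f y w) x) l ≈ transfer (λ y → ∑ (f y) l) x
      transfer-∑ f []      x = sym (transfer-zero x)
      transfer-∑ f (w ∷ l) x = trans (+-cong refl (transfer-∑ f l x)) (transfer-+ (λ y → f y w) _ x)

      evalShift-transfer : ∀ p (g : ℕ → ℤ → Carrier) x N →
        evalShift p (λ M → transfer (λ y → g y M) x) N ≈ transfer (λ y → evalShift p (g y) N) x
      evalShift-transfer []      g x N = sym (transfer-zero x)
      evalShift-transfer (a ∷ p) g x N =
        trans (+-cong (sym (transfer-*ˡ a (λ y → g y N) x)) (evalShift-transfer p g x (ℤ.suc N)))
              (transfer-+ (λ y → a * g y N) (λ y → evalShift p (g y) (ℤ.suc N)) x)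

      Solves : (ℕ → ℤ → Carrier) → Set ℓ
      Solves z = ∀ x N → x ≤ K → z x (ℤ.suc N) ≈ transfer (λ y → z y N) x

      nextPoly-upper : ∀ {z} → Solves z → ∀ x → x ≤ K → ∀ {p p′} N →
                    (∀ M → evalShift p (z 0) M ≈ z x M) → lam x * evalShift p′ (z 0) N ≈ lower (λ y → z y N) x →
                    evalShift (nextPoly x p p′) (z 0) N ≈ upper (λ y → z y N) x
      nextPoly-upper {z} sol x x≤K {p} {p′} N P≈z P′≈lower = begin
        evalShift (nextPoly x p p′) (z 0) N
          ≈⟨ evalShift-nextPoly x p p′ (z 0) N ⟩
        evalShift p (z 0) (ℤ.suc N) + ((- b x) * evalShift p (z 0) N + (- lam x) * evalShift p′ (z 0) N)
          ≈⟨ +-cong (P≈z (ℤ.suc N)) (+-cong (trans (sym (-‿distribˡ-* _ _)) (-‿cong (*-cong refl (P≈z N))))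
                                            (trans (sym (-‿distribˡ-* _ _)) (-‿cong P′≈lower))) ⟩
        z x (ℤ.suc N) + (- (b x * z x N) + - lower (λ y → z y N) x)
          ≈⟨ +-cong (sol x N x≤K) refl ⟩
        (upper z′ x + (b x * z x N + lower z′ x)) + (- (b x * z x N) + - lower z′ x)
          ≈⟨ +-cong refl (-‿+-comm _ _) ⟩
        (upper z′ x + (b x * z x N + lower z′ x)) + - (b x * z x N + lower z′ x)
          ≈⟨ +-assoc _ _ _ ⟩
        upper z′ x + ((b x * z x N + lower z′ x) + - (b x * z x N + lower z′ x))
          ≈⟨ +-cong refl (-‿inverseʳ _) ⟩
        upper z′ x + 0#
          ≈⟨ +-identityʳ _ ⟩
        upper z′ x ∎
        where z′ = λ y → z y N

      orthoPolys-solution : ∀ {z} → Solves z → ∀ x → x ≤ K → ∀ N →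
          (evalShift (proj₁ (orthoPolys x)) (z 0) N ≈ z x N)
        × (evalShift (proj₂ (orthoPolys x)) (z 0) N ≈ upper (λ y → z y N) x)
      orthoPolys-solution {z} sol zero    x≤K N =
        P₀ N , nextPoly-upper sol 0 x≤K {1# ∷ []} {[]} N P₀ (zeroʳ _)
        where
        P₀ : ∀ M → evalShift (1# ∷ []) (z 0) M ≈ z 0 M
        P₀ M = trans (+-identityʳ _) (*-identityˡ _)
      orthoPolys-solution {z} sol (suc x) x≤K N =
        Pₓ₊₁ N , nextPoly-upper sol (suc x) x≤K {proj₂ (orthoPolys x)} {proj₁ (orthoPolys x)} N
                                Pₓ₊₁ (*-cong refl (proj₁ (previous N)))
        where
        previous : ∀ M → (evalShift (proj₁ (orthoPolys x)) (z 0) M ≈ z x M)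
                         × (evalShift (proj₂ (orthoPolys x)) (z 0) M ≈ upper (λ y → z y M) x)
        previous = orthoPolys-solution sol x (ℕP.<⇒≤ x≤K)
        Pₓ₊₁ : ∀ M → evalShift (proj₂ (orthoPolys x)) (z 0) M ≈ z (suc x) M
        Pₓ₊₁ M = trans (proj₂ (previous M)) upper-inside
          where
          upper-inside : upper (λ y → z y M) x ≈ z (suc x) M
          upper-inside rewrite <ᵇ-false x≤K = refl

      charPoly : List Carrier
      charPoly = proj₂ (orthoPolys K)

      -- evalShift charPoly maps solutions to solutions, and the one it produces has row 0 equal to
      -- upper z K = 0; a solution is determined by its row 0.
      charPoly-annihilates : ∀ {z} → Solves z → ∀ x → x ≤ K → ∀ N → evalShift charPoly (z x) N ≈ 0#
      charPoly-annihilates {z} sol x x≤K N = begin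
        evalShift charPoly (z x) N                  ≈⟨ sym (proj₁ (orthoPolys-solution sol′ x x≤K N)) ⟩
        evalShift (proj₁ (orthoPolys x)) (w 0) N    ≈⟨ evalShift-cong (proj₁ (orthoPolys x)) w₀≈0 N ⟩
        evalShift (proj₁ (orthoPolys x)) (λ _ → 0#) N ≈⟨ evalShift-zero (proj₁ (orthoPolys x)) N ⟩
        0#                                          ∎
        where
        w : ℕ → ℤ → Carrier
        w y = evalShift charPoly (z y)
        sol′ : Solves w
        sol′ y M y≤K = trans (sym (evalShift-suc charPoly (z y) M))
                         (trans (evalShift-cong charPoly (λ M′ → sol y M′ y≤K) M) (evalShift-transfer charPoly z y M))
        w₀≈0 : ∀ M → w 0 M ≈ 0#
        w₀≈0 M = trans (proj₂ (orthoPolys-solution sol K ℕP.≤-refl M)) upper-top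
          where
          upper-top : upper (λ y → z y M) K ≈ 0#
          upper-top rewrite <ᵇ-true (ℕP.n<1+n K) = refl

  module Weights (V Vinv : ℕ → Carrier) (inv : ∀ i → V i * Vinv i ≈ 1#) where
    open Jacobi (bW F V Vinv) (λW F V Vinv)

    module Paths (K s : ℕ) where
      open Truncated K

      pathTerm : ℕ → List Step → List Carrier
      pathTerm x w = if endsAt (walk K x w) s then [ pathWeight F V Vinv x w ] else []

      pathTerm-up : ∀ x w → sumR F (pathTerm x (up ∷ w)) ≈ upper (λ y → sumR F (pathTerm y w)) x
      pathTerm-up x w with K <ᵇ suc x
      ... | true  = refl
      ... | false = refl

      pathTerm-flat : ∀ x w → sumR F (pathTerm x (flat ∷ w)) ≈ bW F V Vinv x * sumR F (pathTerm x w)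
      pathTerm-flat x w with endsAt (walk K x w) s
      ... | true  = trans (+-identityʳ _) (*-cong refl (sym (+-identityʳ _)))
      ... | false = sym (zeroʳ _)

      pathTerm-down : ∀ x w → sumR F (pathTerm x (down ∷ w)) ≈ lower (λ y → sumR F (pathTerm y w)) x
      pathTerm-down zero    w = refl
      pathTerm-down (suc x) w with endsAt (walk K x w) s
      ... | true  = trans (+-identityʳ _) (*-cong refl (sym (+-identityʳ _)))
      ... | false = sym (zeroʳ _)

      mu-suc : ∀ N x → mu F V Vinv K (suc N) x s ≈ transfer (λ y → mu F V Vinv K N y s) x
      mu-suc N x = begin
        mu F V Vinv K (suc N) x s
          ≈⟨ sumR-concatMap (pathTerm x) (allSteps (suc N)) ⟩
        ∑ (λ w → sumR F (pathTerm x w)) (concatMap extend (allSteps N))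
          ≈⟨ ∑-concatMap _ extend (allSteps N) ⟩
        ∑ (λ w → ∑ (λ w′ → sumR F (pathTerm x w′)) (extend w)) (allSteps N)
          ≈⟨ ∑-cong (allSteps N) (λ w → +-cong (pathTerm-up x w)
                                     (+-cong (pathTerm-flat x w) (trans (+-identityʳ _) (pathTerm-down x w)))) ⟩
        ∑ (λ w → transfer (λ y → sumR F (pathTerm y w)) x) (allSteps N)
          ≈⟨ transfer-∑ (λ y w → sumR F (pathTerm y w)) (allSteps N) x ⟩
        transfer (λ y → ∑ (λ w → sumR F (pathTerm y w)) (allSteps N)) x
          ≈⟨ transfer-cong (λ y → sym (sumR-concatMap (pathTerm y) (allSteps N))) x ⟩
        transfer (λ y → mu F V Vinv K N y s) x ∎
        where
        extend : List Step → List (List Step)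
        extend w = (up ∷ w) ∷ (flat ∷ w) ∷ (down ∷ w) ∷ []

      mu-zero : ∀ x → mu F V Vinv K 0 x s ≈ 𝟙 (x ≡ᵇ s)
      mu-zero x with x ≡ᵇ s
      ... | true  = +-identityʳ _
      ... | false = refl

    module PeakValleys (K : ℕ) where

      pvTerm : ℕ → ℕ → List ℕ → List Carrier
      pvTerm y t l = if isPV y t l then [ wt F V Vinv l ] else []

      pvTerm-∷ : ∀ y t a w → sumR F (pvTerm y t (a ∷ w)) ≈ 𝟙 (isPV y a []) * (V a * sumR F (pvTerm a t w))
      pvTerm-∷ y t a w rewrite isPV-∷ y t a w with isPV y a [] | isPV a t w
      ... | true  | true  = trans (+-identityʳ _) (sym (trans (*-identityˡ _) (*-cong refl (+-identityʳ _))))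
      ... | true  | false = sym (trans (*-identityˡ _) (zeroʳ _))
      ... | false | _     = sym (zeroˡ _)

      pvSum-suc : ∀ N y t → pvSum F V Vinv K (suc N) y t
                            ≈ ∑ (λ a → 𝟙 (isPV y a []) * (V a * pvSum F V Vinv K N a t)) (upTo (suc K))
      pvSum-suc N y t = begin
        pvSum F V Vinv K (suc N) y t
          ≈⟨ sumR-concatMap (pvTerm y t) (allSeqs K (suc N)) ⟩
        ∑ (λ l → sumR F (pvTerm y t l)) (concatMap (λ w → map (_∷ w) U) L)
          ≈⟨ ∑-concatMap _ _ L ⟩
        ∑ (λ w → ∑ (λ l → sumR F (pvTerm y t l)) (map (_∷ w) U)) L
          ≈⟨ ∑-cong L (λ w → ∑-map _ (_∷ w) U) ⟩
        ∑ (λ w → ∑ (λ a → sumR F (pvTerm y t (a ∷ w))) U) L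
          ≈⟨ ∑-comm (λ w a → sumR F (pvTerm y t (a ∷ w))) L U ⟩
        ∑ (λ a → ∑ (λ w → sumR F (pvTerm y t (a ∷ w))) L) U
          ≈⟨ ∑-cong U (λ a → ∑-cong L (λ w → pvTerm-∷ y t a w)) ⟩
        ∑ (λ a → ∑ (λ w → 𝟙 (isPV y a []) * (V a * sumR F (pvTerm a t w))) L) U
          ≈⟨ ∑-cong U (λ a → trans (∑-*ˡ _ _ L) (*-cong refl (∑-*ˡ _ _ L))) ⟩
        ∑ (λ a → 𝟙 (isPV y a []) * (V a * ∑ (λ w → sumR F (pvTerm a t w)) L)) U
          ≈⟨ ∑-cong U (λ a → *-cong refl (*-cong refl (sym (sumR-concatMap (pvTerm a t) L)))) ⟩
        ∑ (λ a → 𝟙 (isPV y a []) * (V a * pvSum F V Vinv K N a t)) U ∎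
        where
        U = upTo (suc K)
        L = allSeqs K N

      pvSum-zero : ∀ y t → pvSum F V Vinv K 0 y t ≈ 𝟙 (isPV y t [])
      pvSum-zero y t with isPV y t []
      ... | true  = +-identityʳ _
      ... | false = refl

    ΠV ΠI : ℕ → Carrier
    ΠV = prodUpTo F V
    ΠI = prodUpTo F Vinv

    ΠV*ΠI≈1 : ∀ n → ΠV n * ΠI n ≈ 1#
    ΠV*ΠI≈1 zero    = *-identityˡ 1#
    ΠV*ΠI≈1 (suc n) = begin
      (ΠV n * V n) * (ΠI n * Vinv n)  ≈⟨ interchange _ _ _ _ ⟩
      (ΠV n * ΠI n) * (V n * Vinv n)  ≈⟨ *-cong (ΠV*ΠI≈1 n) (inv n) ⟩
      1# * 1#                         ≈⟨ *-identityˡ 1# ⟩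
      1#                              ∎

    ΠV-+1 : ∀ x → ΠV (x ℕ.+ 1) ≡ ΠV x * V x
    ΠV-+1 x = ≡.cong ΠV (ℕP.+-comm x 1)

    gauge : ℕ → ℕ → Carrier
    gauge y t = negOnePow F (y / 3 ℕ.+ t / 3) * (ΠV (t ℕ.+ 1) * ΠI y)

    gauge-product : ∀ y a t → gauge y a * gauge a t ≈ gauge y t * V a
    gauge-product y a t = begin
      gauge y a * gauge a t
        ≈⟨ *-cong (*-cong (negOnePow-+ (y / 3) (a / 3)) (*-cong (reflexive (ΠV-+1 a)) refl))
                  (*-cong (negOnePow-+ (a / 3) (t / 3)) refl) ⟩
      (νy * νa * ((ΠV a * V a) * ΠI y)) * (νa * νt * (ΠV (t ℕ.+ 1) * ΠI a))
        ≈⟨ prove 8 (((x₀ ⊕ x₁) ⊕ ((x₂ ⊕ x₃) ⊕ x₄)) ⊕ ((x₁ ⊕ x₅) ⊕ (x₆ ⊕ x₇)))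
                   (((x₁ ⊕ x₁) ⊕ (x₂ ⊕ x₇)) ⊕ (((x₀ ⊕ x₅) ⊕ (x₆ ⊕ x₄)) ⊕ x₃))
                   (νy ∷ᵥ νa ∷ᵥ ΠV a ∷ᵥ V a ∷ᵥ ΠI y ∷ᵥ νt ∷ᵥ ΠV (t ℕ.+ 1) ∷ᵥ ΠI a ∷ᵥ []ᵥ) ⟩
      ((νa * νa) * (ΠV a * ΠI a)) * ((νy * νt * (ΠV (t ℕ.+ 1) * ΠI y)) * V a)
        ≈⟨ *-cong (*-cong (negOnePow-square (a / 3)) (ΠV*ΠI≈1 a))
                  (*-cong (*-cong (sym (negOnePow-+ (y / 3) (t / 3))) refl) refl) ⟩
      (1# * 1#) * (gauge y t * V a)
        ≈⟨ trans (*-cong (*-identityˡ 1#) refl) (*-identityˡ _) ⟩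
      gauge y t * V a ∎
      where
      νy = negOnePow F (y / 3)
      νa = negOnePow F (a / 3)
      νt = negOnePow F (t / 3)

    -- the right-hand side of the theorem for n = m + 1
    G : ℕ → ℕ → ℕ → ℕ → Carrier
    G K m y t = gauge y t * pvSum F V Vinv K m y t

    module Inverse (K : ℕ) (K≡2 : residue K ≡ r2) where
      open Truncated K
      open PeakValleys K

      column : ℕ → ℕ → Carrier
      column a y = negOnePow F (y / 3) * (ΠI y * 𝟙 (isPV y a []))

      rowScale : ℕ → Carrier
      rowScale x = negOnePow F (x / 3) * (Vinv x * ΠI x)

      upper-column : ∀ {x a} o → OffsetOf x a o → upper (column a) x
                     ≈ rowScale x * signed (carrySign (residue x) ,
                                            not (K <ᵇ suc x) ∧ admissible (next (residue x)) (residue a) (side⁺ o))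
      upper-column {x} {a} o off with K <ᵇ suc x
      ... | true  = sym (trans (*-cong refl (zeroʳ _)) (zeroʳ _))
      ... | false = begin
        negOnePow F (suc x / 3) * ((ΠI x * Vinv x) * e)
          ≈⟨ *-cong (negOnePow-/3-suc x) refl ⟩
        (⟦ σ ⟧ * ν) * ((ΠI x * Vinv x) * e)
          ≈⟨ prove 5 ((x₀ ⊕ x₁) ⊕ ((x₂ ⊕ x₃) ⊕ x₄)) ((x₁ ⊕ (x₃ ⊕ x₂)) ⊕ (x₀ ⊕ x₄))
                   (⟦ σ ⟧ ∷ᵥ ν ∷ᵥ ΠI x ∷ᵥ Vinv x ∷ᵥ e ∷ᵥ []ᵥ) ⟩
        rowScale x * (⟦ σ ⟧ * e)
          ≈⟨ *-cong refl (*-cong refl (reflexive (≡.cong 𝟙 (isPV-side⁺ o off)))) ⟩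
        rowScale x * (⟦ σ ⟧ * 𝟙 (admissible (next (residue x)) (residue a) (side⁺ o))) ∎
        where
        σ = carrySign (residue x)
        ν = negOnePow F (x / 3)
        e = 𝟙 (isPV (suc x) a [])

      flat-column : ∀ {x a} o → OffsetOf x a o →
                    bW F V Vinv x * column a x ≈ rowScale x * signed (minus , admissible (residue x) (residue a) (side⁰ o))
      flat-column {x} {a} o off = begin
        (- Vinv x) * (ν * (ΠI x * e))
          ≈⟨ sym (-‿distribˡ-* _ _) ⟩
        - (Vinv x * (ν * (ΠI x * e)))
          ≈⟨ -‿cong (prove 4 (x₀ ⊕ (x₁ ⊕ (x₂ ⊕ x₃))) ((x₁ ⊕ (x₀ ⊕ x₂)) ⊕ x₃)
                           (Vinv x ∷ᵥ ν ∷ᵥ ΠI x ∷ᵥ e ∷ᵥ []ᵥ)) ⟩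
        - (rowScale x * e)
          ≈⟨ -‿distribʳ-* _ _ ⟩
        rowScale x * (- e)
          ≈⟨ *-cong refl (sym (-1*x≈-x e)) ⟩
        rowScale x * (- 1# * e)
          ≈⟨ *-cong refl (*-cong refl (reflexive (≡.cong 𝟙 (isPV-side⁰ o off)))) ⟩
        rowScale x * signed (minus , admissible (residue x) (residue a) (side⁰ o)) ∎
        where
        ν = negOnePow F (x / 3)
        e = 𝟙 (isPV x a [])

      lower-column : ∀ {x a} o → OffsetOf x a o → lower (column a) x
                     ≈ rowScale x * signed (carrySign (prev (residue x)) ,
                                            not (x ≡ᵇ 0) ∧ admissible (prev (residue x)) (residue a) (side⁻ o))
      lower-column {zero}  o off = sym (trans (*-cong refl (zeroʳ _)) (zeroʳ _))
      lower-column {suc x} {a} o off = begin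
        (Vinv (suc x) * Vinv x) * (negOnePow F (x / 3) * (ΠI x * e))
          ≈⟨ *-cong refl (*-cong (negOnePow-/3 x) refl) ⟩
        (Vinv (suc x) * Vinv x) * ((⟦ σ ⟧ * ν) * (ΠI x * e))
          ≈⟨ prove 6 ((x₀ ⊕ x₁) ⊕ ((x₂ ⊕ x₃) ⊕ (x₄ ⊕ x₅))) ((x₃ ⊕ (x₀ ⊕ (x₄ ⊕ x₁))) ⊕ (x₂ ⊕ x₅))
                     (Vinv (suc x) ∷ᵥ Vinv x ∷ᵥ ⟦ σ ⟧ ∷ᵥ ν ∷ᵥ ΠI x ∷ᵥ e ∷ᵥ []ᵥ) ⟩
        rowScale (suc x) * (⟦ σ ⟧ * e)
          ≈⟨ *-cong refl (*-cong (reflexive (≡.cong (λ i → ⟦ carrySign i ⟧) (prev-residue-suc x)))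
                                 (reflexive (≡.cong 𝟙 (isPV-side⁻ o off)))) ⟩
        rowScale (suc x) * signed (carrySign (prev (residue (suc x))) ,
                                  admissible (prev (residue (suc x))) (residue a) (side⁻ o)) ∎
        where
        σ = carrySign (residue x)
        ν = negOnePow F (suc x / 3)
        e = 𝟙 (isPV x a [])

      transfer-column : ∀ {x a} → x ≤ K → a ≤ K → transfer (column a) x ≈ rowScale x * 𝟙 (x ≡ᵇ a)
      transfer-column {x} {a} x≤K a≤K = begin
        upper (column a) x + (bW F V Vinv x * column a x + lower (column a) x)
          ≈⟨ +-cong (upper-column o off) (+-cong (flat-column o off) (lower-column o off)) ⟩
        rowScale x * signed t₁ + (rowScale x * signed t₂ + rowScale x * signed t₃)
          ≈⟨ sym (trans (distribˡ _ _ _)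
                        (+-cong refl (trans (distribˡ _ _ _) (+-cong refl (*-cong refl (+-identityʳ _)))))) ⟩
        rowScale x * ∑ signed terms
          ≈⟨ *-cong refl (balanced-sound terms _ (transferTerms-balanced (residue x) (residue a) o (K <ᵇ suc x) (x ≡ᵇ 0)
                                                    (consistent-offset o K≡2 x≤K a≤K off))) ⟩
        rowScale x * 𝟙 (isLevel (side⁰ o))
          ≈⟨ *-cong refl (reflexive (≡.cong 𝟙 (≡.sym (≡ᵇ-side (side⁰ o) (side⁰-spec o off))))) ⟩
        rowScale x * 𝟙 (x ≡ᵇ a) ∎
        where
        o = proj₁ (offset x a)
        off = proj₂ (offset x a)
        terms = transferTerms (residue x) (residue a) o (K <ᵇ suc x) (x ≡ᵇ 0)
        t₁ = carrySign (residue x) , not (K <ᵇ suc x) ∧ admissible (next (residue x)) (residue a) (side⁺ o)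
        t₂ = minus , admissible (residue x) (residue a) (side⁰ o)
        t₃ = carrySign (prev (residue x)) , not (x ≡ᵇ 0) ∧ admissible (prev (residue x)) (residue a) (side⁻ o)

      columnScale : ℕ → Carrier
      columnScale a = negOnePow F (a / 3) * ΠV (a ℕ.+ 1)

      G₀≈column : ∀ y a → G K 0 y a ≈ columnScale a * column a y
      G₀≈column y a = begin
        gauge y a * pvSum F V Vinv K 0 y a
          ≈⟨ *-cong (*-cong (negOnePow-+ (y / 3) (a / 3)) refl) (pvSum-zero y a) ⟩
        ((νy * νa) * (ΠV (a ℕ.+ 1) * ΠI y)) * e
          ≈⟨ prove 5 (((x₀ ⊕ x₁) ⊕ (x₂ ⊕ x₃)) ⊕ x₄) ((x₁ ⊕ x₂) ⊕ (x₀ ⊕ (x₃ ⊕ x₄)))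
                   (νy ∷ᵥ νa ∷ᵥ ΠV (a ℕ.+ 1) ∷ᵥ ΠI y ∷ᵥ e ∷ᵥ []ᵥ) ⟩
        columnScale a * column a y ∎
        where
        νy = negOnePow F (y / 3)
        νa = negOnePow F (a / 3)
        e = 𝟙 (isPV y a [])

      columnScale*rowScale : ∀ x → columnScale x * rowScale x ≈ 1#
      columnScale*rowScale x = begin
        (ν * ΠV (x ℕ.+ 1)) * (ν * (Vinv x * ΠI x))
          ≈⟨ *-cong (*-cong refl (reflexive (ΠV-+1 x))) refl ⟩
        (ν * (ΠV x * V x)) * (ν * (Vinv x * ΠI x))
          ≈⟨ prove 5 ((x₀ ⊕ (x₁ ⊕ x₂)) ⊕ (x₀ ⊕ (x₃ ⊕ x₄))) ((x₀ ⊕ x₀) ⊕ ((x₁ ⊕ x₄) ⊕ (x₂ ⊕ x₃)))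
                   (ν ∷ᵥ ΠV x ∷ᵥ V x ∷ᵥ Vinv x ∷ᵥ ΠI x ∷ᵥ []ᵥ) ⟩
        (ν * ν) * ((ΠV x * ΠI x) * (V x * Vinv x))
          ≈⟨ *-cong (negOnePow-square (x / 3)) (*-cong (ΠV*ΠI≈1 x) (inv x)) ⟩
        1# * (1# * 1#)
          ≈⟨ trans (*-identityˡ _) (*-identityˡ _) ⟩
        1# ∎
        where
        ν = negOnePow F (x / 3)

      transfer-G₀ : ∀ {x a} → x ≤ K → a ≤ K → transfer (λ y → G K 0 y a) x ≈ 𝟙 (x ≡ᵇ a)
      transfer-G₀ {x} {a} x≤K a≤K = begin
        transfer (λ y → G K 0 y a) x                       ≈⟨ transfer-cong (λ y → G₀≈column y a) x ⟩
        transfer (λ y → columnScale a * column a y) x      ≈⟨ transfer-*ˡ (columnScale a) (column a) x ⟩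
        columnScale a * transfer (column a) x              ≈⟨ *-cong refl (transfer-column x≤K a≤K) ⟩
        columnScale a * (rowScale x * 𝟙 (x ≡ᵇ a))          ≈⟨ diagonal ⟩
        𝟙 (x ≡ᵇ a)                                         ∎
        where
        diagonal : columnScale a * (rowScale x * 𝟙 (x ≡ᵇ a)) ≈ 𝟙 (x ≡ᵇ a)
        diagonal with x ≡ᵇ a in x≡ᵇa
        ... | false = trans (*-cong refl (zeroʳ _)) (zeroʳ _)
        ... | true with ℕP.≡ᵇ⇒≡ x a (≡.subst T (≡.sym x≡ᵇa) _)
        ...   | ≡.refl = trans (*-cong refl (*-identityʳ _)) (columnScale*rowScale x)

      G-suc : ∀ m y t → G K (suc m) y t ≈ ∑ (λ a → G K 0 y a * G K m a t) (upTo (suc K))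
      G-suc m y t = begin
        gauge y t * pvSum F V Vinv K (suc m) y t
          ≈⟨ *-cong refl (pvSum-suc m y t) ⟩
        gauge y t * ∑ (λ a → 𝟙 (isPV y a []) * (V a * pvSum F V Vinv K m a t)) U
          ≈⟨ sym (∑-*ˡ _ _ U) ⟩
        ∑ (λ a → gauge y t * (𝟙 (isPV y a []) * (V a * pvSum F V Vinv K m a t))) U
          ≈⟨ ∑-cong U term ⟩
        ∑ (λ a → G K 0 y a * G K m a t) U ∎
        where
        U = upTo (suc K)
        term : ∀ a → gauge y t * (𝟙 (isPV y a []) * (V a * pvSum F V Vinv K m a t)) ≈ G K 0 y a * G K m a t
        term a = begin
          gauge y t * (e * (V a * w))
            ≈⟨ prove 4 (x₀ ⊕ (x₁ ⊕ (x₂ ⊕ x₃))) ((x₀ ⊕ x₂) ⊕ (x₁ ⊕ x₃))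
                     (gauge y t ∷ᵥ e ∷ᵥ V a ∷ᵥ w ∷ᵥ []ᵥ) ⟩
          (gauge y t * V a) * (e * w)
            ≈⟨ *-cong (sym (gauge-product y a t)) refl ⟩
          (gauge y a * gauge a t) * (e * w)
            ≈⟨ interchange _ _ _ _ ⟩
          (gauge y a * e) * (gauge a t * w)
            ≈⟨ *-cong (*-cong refl (sym (pvSum-zero y a))) refl ⟩
          G K 0 y a * G K m a t                ∎
          where
          e = 𝟙 (isPV y a [])
          w = pvSum F V Vinv K m a t

      -- (A^N) x s for N ≥ 0, continued by A^(-1-m) = G m
      extension : ℕ → ℕ → ℤ → Carrier
      extension s x (ℤ.+ n)    = mu F V Vinv K n x s
      extension s x -[1+ m ] = G K m x s

      extension-solves : ∀ {s} → s ≤ K → Solves (extension s)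
      extension-solves {s} s≤K x (ℤ.+ n) x≤K = Paths.mu-suc K s n x
      extension-solves {s} s≤K x -[1+ 0 ] x≤K = trans (Paths.mu-zero K s x) (sym (transfer-G₀ x≤K s≤K))
      extension-solves {s} s≤K x -[1+ suc m ] x≤K = sym (begin
        transfer (λ y → G K (suc m) y s) x
          ≈⟨ transfer-cong (λ y → G-suc m y s) x ⟩
        transfer (λ y → ∑ (λ a → G K 0 y a * G K m a s) U) x
          ≈⟨ sym (transfer-∑ (λ y a → G K 0 y a * G K m a s) U x) ⟩
        ∑ (λ a → transfer (λ y → G K 0 y a * G K m a s) x) U
          ≈⟨ ∑-cong U (λ a → transfer-*ʳ (G K m a s) (λ y → G K 0 y a) x) ⟩
        ∑ (λ a → transfer (λ y → G K 0 y a) x * G K m a s) U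
          ≈⟨ ∑-upTo-cong (suc K) (λ a a<1+K → *-cong (transfer-G₀ x≤K (ℕP.≤-pred a<1+K)) refl) ⟩
        ∑ (λ a → 𝟙 (x ≡ᵇ a) * G K m a s) U
          ≈⟨ ∑-δ (λ a → G K m a s) (suc K) x (s≤s x≤K) ⟩
        G K m x s                                                 ∎)
        where U = upTo (suc K)

    periodSix : ℕ → Carrier
    periodSix 0                   = 1#
    periodSix 1                   = 1#
    periodSix (suc (suc n)) = periodSix (suc n) - periodSix n

    periodSix-+3 : ∀ n → periodSix (3 ℕ.+ n) ≈ - periodSix n
    periodSix-+3 n = begin
      (periodSix (suc n) - periodSix n) - periodSix (suc n)  ≈⟨ +-cong (+-comm _ _) refl ⟩
      (- periodSix n + periodSix (suc n)) - periodSix (suc n) ≈⟨ +-assoc _ _ _ ⟩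
      - periodSix n + (periodSix (suc n) - periodSix (suc n)) ≈⟨ +-cong refl (-‿inverseʳ _) ⟩
      - periodSix n + 0#                                     ≈⟨ +-identityʳ _ ⟩
      - periodSix n                                          ∎

    periodSix-*3-square : ∀ j → periodSix (j ℕ.* 3) * periodSix (j ℕ.* 3) ≈ 1#
    periodSix-*3-square zero    = *-identityˡ 1#
    periodSix-*3-square (suc j) = begin
      periodSix (3 ℕ.+ u) * periodSix (3 ℕ.+ u)  ≈⟨ *-cong (periodSix-+3 u) (periodSix-+3 u) ⟩
      - periodSix u * - periodSix u              ≈⟨ sym (-‿distribˡ-* _ _) ⟩
      - (periodSix u * - periodSix u)            ≈⟨ -‿cong (sym (-‿distribʳ-* _ _)) ⟩
      - - (periodSix u * periodSix u)            ≈⟨ -‿involutive _ ⟩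
      periodSix u * periodSix u                  ≈⟨ periodSix-*3-square j ⟩
      1#                                         ∎
      where u = j ℕ.* 3

    constantTerm-nextPoly-scaled : ∀ x p p′ → constantTerm (nextPoly (suc x) p p′) * ΠV (suc (suc x))
                                   ≈ constantTerm p * ΠV (suc x) - constantTerm p′ * ΠV x
    constantTerm-nextPoly-scaled x p p′ = begin
      constantTerm (nextPoly (suc x) p p′) * (Q * V (suc x))
        ≈⟨ *-cong (constantTerm-nextPoly (suc x) p p′) refl ⟩
      ((- - Vinv (suc x)) * κ + (- (Vinv (suc x) * Vinv x)) * d′) * (Q * V (suc x))
        ≈⟨ distribʳ _ _ _ ⟩
      (- - Vinv (suc x)) * κ * (Q * V (suc x)) + (- (Vinv (suc x) * Vinv x)) * d′ * (Q * V (suc x))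
        ≈⟨ +-cong first second ⟩
      κ * Q - d′ * ΠV x ∎
      where
      κ = constantTerm p
      d′ = constantTerm p′
      Q = ΠV (suc x)
      first : (- - Vinv (suc x)) * κ * (Q * V (suc x)) ≈ κ * Q
      first = begin
        (- - Vinv (suc x)) * κ * (Q * V (suc x))
          ≈⟨ *-cong (*-cong (-‿involutive _) refl) refl ⟩
        Vinv (suc x) * κ * (Q * V (suc x))
          ≈⟨ prove 4 ((x₀ ⊕ x₁) ⊕ (x₂ ⊕ x₃)) ((x₃ ⊕ x₀) ⊕ (x₁ ⊕ x₂)) (Vinv (suc x) ∷ᵥ κ ∷ᵥ Q ∷ᵥ V (suc x) ∷ᵥ []ᵥ) ⟩
        (V (suc x) * Vinv (suc x)) * (κ * Q)
          ≈⟨ *-cong (inv (suc x)) refl ⟩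
        1# * (κ * Q)
          ≈⟨ *-identityˡ _ ⟩
        κ * Q                                     ∎
      second : (- (Vinv (suc x) * Vinv x)) * d′ * (Q * V (suc x)) ≈ - (d′ * ΠV x)
      second = begin
        (- (Vinv (suc x) * Vinv x)) * d′ * (Q * V (suc x))
          ≈⟨ *-cong (sym (-‿distribˡ-* _ _)) refl ⟩
        - (Vinv (suc x) * Vinv x * d′) * (Q * V (suc x))
          ≈⟨ sym (-‿distribˡ-* _ _) ⟩
        - (Vinv (suc x) * Vinv x * d′ * ((ΠV x * V x) * V (suc x)))
          ≈⟨ -‿cong (prove 6 (((x₀ ⊕ x₁) ⊕ x₂) ⊕ ((x₃ ⊕ x₄) ⊕ x₅)) ((x₅ ⊕ x₀) ⊕ ((x₄ ⊕ x₁) ⊕ (x₂ ⊕ x₃)))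
                             (Vinv (suc x) ∷ᵥ Vinv x ∷ᵥ d′ ∷ᵥ ΠV x ∷ᵥ V x ∷ᵥ V (suc x) ∷ᵥ []ᵥ)) ⟩
        - ((V (suc x) * Vinv (suc x)) * ((V x * Vinv x) * (d′ * ΠV x)))
          ≈⟨ -‿cong (*-cong (inv (suc x)) (*-cong (inv x) refl)) ⟩
        - (1# * (1# * (d′ * ΠV x)))
          ≈⟨ -‿cong (trans (*-identityˡ _) (*-identityˡ _)) ⟩
        - (d′ * ΠV x)                                        ∎

    constantTerm-orthoPolys : ∀ x → (constantTerm (proj₁ (orthoPolys x)) * ΠV x ≈ periodSix x)
                                  × (constantTerm (proj₂ (orthoPolys x)) * ΠV (suc x) ≈ periodSix (suc x))
    constantTerm-orthoPolys zero    = *-identityˡ 1# , (begin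
      constantTerm (nextPoly 0 (1# ∷ []) []) * (1# * V 0)
        ≈⟨ *-cong (constantTerm-nextPoly 0 (1# ∷ []) []) (*-identityˡ _) ⟩
      ((- - Vinv 0) * 1# + (- λW F V Vinv 0) * 0#) * V 0
        ≈⟨ *-cong (trans (+-cong (*-identityʳ _) (zeroʳ _)) (trans (+-identityʳ _) (-‿involutive _))) refl ⟩
      Vinv 0 * V 0
        ≈⟨ trans (*-comm _ _) (inv 0) ⟩
      1# ∎)
    constantTerm-orthoPolys (suc x) = proj₂ (constantTerm-orthoPolys x) , (begin
      constantTerm (nextPoly (suc x) (proj₂ (orthoPolys x)) (proj₁ (orthoPolys x))) * ΠV (suc (suc x))
        ≈⟨ constantTerm-nextPoly-scaled x (proj₂ (orthoPolys x)) (proj₁ (orthoPolys x)) ⟩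
      constantTerm (proj₂ (orthoPolys x)) * ΠV (suc x) - constantTerm (proj₁ (orthoPolys x)) * ΠV x
        ≈⟨ +-cong (proj₂ (constantTerm-orthoPolys x)) (-‿cong (proj₁ (constantTerm-orthoPolys x))) ⟩
      periodSix (suc (suc x)) ∎)

    module Uniqueness (k K : ℕ) (K≡ : K ≡ 2 ℕ.+ k ℕ.* 3) where
      open Truncated K

      residue-K : residue K ≡ r2
      residue-K = ≡.cong residueOf (≡.trans (≡.cong (ℕ._% 3) K≡) (ℕDM.[m+kn]%n≡m%n 2 k 3))

      open Inverse K residue-K

      charPoly≉0 : ¬ constantTerm charPoly ≈ 0#
      charPoly≉0 charPoly≈0 = 1≉0 (begin
        1#
          ≈⟨ sym (periodSix-*3-square (suc k)) ⟩
        periodSix (suc k ℕ.* 3) * periodSix (suc k ℕ.* 3)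
          ≈⟨ reflexive (≡.cong (λ n → periodSix n * periodSix n) (≡.cong suc (≡.sym K≡))) ⟩
        periodSix (suc K) * periodSix (suc K)
          ≈⟨ *-cong (sym (proj₂ (constantTerm-orthoPolys K))) refl ⟩
        (constantTerm charPoly * ΠV (suc K)) * periodSix (suc K)
          ≈⟨ *-cong (*-cong charPoly≈0 refl) refl ⟩
        (0# * ΠV (suc K)) * periodSix (suc K)
          ≈⟨ trans (*-cong (zeroˡ _) refl) (zeroˡ _) ⟩
        0#                                                ∎)

      -- The recurrence for g transfers to evalShift charPoly g, which vanishes on ℕ and hence
      -- everywhere; so g − extension is annihilated by charPoly and vanishes on ℕ, hence everywhere.
      extension-unique : ∀ {r s} → r ≤ K → s ≤ K → ∀ d (cf : ℕ → Carrier) → ¬ cf (suc d) ≈ 0# →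
        (g : ℤ → Carrier) → (∀ N → g (ℤ.+ N) ≈ mu F V Vinv K N r s) →
        (∀ N → g N ≈ sumFrom1 F (suc d) (λ j → cf j * g (N ℤ.- ℤ.+ j))) →
        ∀ N → g N ≈ extension s r N
      extension-unique {r} {s} r≤K s≤K d cf cf≉0 g g≈mu g-rec N = x∙y⁻¹≈ε⇒x≈y _ _ (δ≈0 N)
        where
        H = extension s r
        H-annihilated : ∀ N → evalShift charPoly H N ≈ 0#
        H-annihilated = charPoly-annihilates (extension-solves s≤K) r r≤K
        w : ℤ → Carrier
        w = evalShift charPoly g
        w-rec : ∀ N → w N ≈ sumFrom1 F (suc d) (λ j → cf j * w (N ℤ.- ℤ.+ j))
        w-rec N = trans (evalShift-cong charPoly g-rec N) (evalShift-sumFrom1 charPoly (suc d) cf g N)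
        w-vanishes : VanishesFrom w (ℤ.+ 0)
        w-vanishes m = trans (evalShift-agreeFrom charPoly (λ m′ → g≈mu (m ℕ.+ m′))) (H-annihilated (ℤ.+ m))
        w≈0 : ∀ N → w N ≈ 0#
        w≈0 = vanishing-backwards (recurrence-step cf≉0 w-rec) 0 w-vanishes
        δ : ℤ → Carrier
        δ M = g M - H M
        δ-annihilated : ∀ N → evalShift charPoly δ N ≈ 0#
        δ-annihilated N = begin
          evalShift charPoly δ N                           ≈⟨ evalShift-- charPoly g H N ⟩
          w N - evalShift charPoly H N                     ≈⟨ +-cong (w≈0 N) (-‿cong (H-annihilated N)) ⟩
          0# - 0#                                          ≈⟨ -‿inverseʳ 0# ⟩
          0#                                               ∎
        δ-vanishes : VanishesFrom δ (ℤ.+ 0)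
        δ-vanishes m = trans (+-cong (g≈mu m) refl) (-‿inverseʳ _)
        δ≈0 : ∀ N → δ N ≈ 0#
        δ≈0 = vanishing-backwards (annihilated-step charPoly charPoly≉0 δ-annihilated) 0 δ-vanishes

3[1+k]∸1≡2+k*3 : ∀ k → 3 ℕ.* suc k ∸ 1 ≡ 2 ℕ.+ k ℕ.* 3
3[1+k]∸1≡2+k*3 k = ≡.trans (≡.cong (_∸ 1) (ℕP.*-suc 3 k)) (≡.cong (2 ℕ.+_) (ℕP.*-comm 3 k))

theorem5p5 : {c ℓ : Level} (F : Field c ℓ) → let open Field F in
    (V Vinv : ℕ → Carrier) → (∀ i → (V i * Vinv i) ≈ 1#) →
    (k n r s : ℕ) → 1 ≤ k → 1 ≤ n → r ≤ 3 ℕ.* k ∸ 1 → s ≤ 3 ℕ.* k ∸ 1 →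
    -- any linear recurrence of order d ≥ 1 with c_d ≠ 0 satisfied by N ↦ μ^{≤3k-1}_{N,r,s} for N ≥ d
    (d : ℕ) (cf : ℕ → Carrier) → 1 ≤ d → ¬ (cf d ≈ 0#) →
    (∀ N → d ≤ N → mu F V Vinv (3 ℕ.* k ∸ 1) N r s
                     ≈ sumFrom1 F d (λ j → cf j * mu F V Vinv (3 ℕ.* k ∸ 1) (N ∸ j) r s)) →
    -- and its extension g to all of ℤ
    (g : ℤ → Carrier) → (∀ N → g (ℤ.+ N) ≈ mu F V Vinv (3 ℕ.* k ∸ 1) N r s) →
    (∀ (N : ℤ) → g N ≈ sumFrom1 F d (λ j → cf j * g (N ℤ.- ℤ.+ j))) →
    g (ℤ.- (ℤ.+ n))
      ≈ negOnePow F (r / 3 ℕ.+ s / 3)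
        * (prodUpTo F V (s ℕ.+ 1) * prodUpTo F Vinv r)
        * pvSum F V Vinv (3 ℕ.* k ∸ 1) (n ∸ 1) r s
theorem5p5 F V Vinv inv (suc k) (suc m) r s _ _ r≤K s≤K (suc d) cf _ cf≉0 _ g g≈mu g-rec =
  extension-unique r≤K s≤K d cf cf≉0 g g≈mu g-rec -[1+ m ]
  where open Weights.Uniqueness F V Vinv inv k (3 ℕ.* suc k ∸ 1) (3[1+k]∸1≡2+k*3 k)
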